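{- Let $k$ be an odd positive integer, let $G=(V,E)$ be a graph, and let $V_0,V_1$ be a partition of $V$. Then there is a colouring $f:E_G(V_0,V)\to\{0,\dots,k-1\}$ such that $s_{(G,f,0)}(v)$ is divisible by $k$ for every $v\in V_0$, and each colour is used on at most $|E_G(V_0,V)|/k+|V_0|$ edges.
   Context: For $A,B\subseteq V$, $E_G(A,B)$ is the set of edges of $G$ of the form $ab$ with $a\in A$, $b\in B$; thus $E_G(V_0,V)$ is the set of edges with at least one endpoint in $V_0$. For an edge subset $E_1\subseteq E$ with a colouring $f:E_1\to\mathbb N$ and a vertex function $g$, $s_{(G,f,g)}(v)=g(v)+\sum_{e\in E_1,\,v\in e} f(e)$; here $g\equiv 0$. -}

module Defs where

open import Data.Nat using (ℕ; _<_)
open import Data.Fin using (Fin; toℕ; _≟_)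
open import Data.Fin.Subset using (Subset; _∈_)
open import Data.Fin.Subset.Properties using (_∈?_)
open import Data.List using (List; filter; map)
open import Data.Nat.ListAction using (sum)
open import Data.List.Relation.Unary.All using (All)
open import Data.List.Relation.Unary.Unique.Propositional using (Unique)
open import Data.Product using (_×_; proj₁; proj₂)
open import Data.Sum using (_⊎_)
open import Relation.Nullary.Decidable using (_⊎-dec_)
open import Relation.Binary.PropositionalEquality using (_≡_)

Edge : ℕ → Set
Edge n = Fin n × Fin n

-- A finite simple graph on vertex set V = Fin n: a duplicate-free list of edges,
-- each stored as (a , b) with a < b (so no loops, no parallel edges).
record Graph (n : ℕ) : Set where
  field
    edges   : List (Edge n)
    ordered : All (λ e → toℕ (proj₁ e) < toℕ (proj₂ e)) edges
    unique  : Unique edges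
open Graph public

_∈ₑ_ : {n : ℕ} → Fin n → Edge n → Set
v ∈ₑ e = (v ≡ proj₁ e) ⊎ (v ≡ proj₂ e)

_∈ₑ?_ : {n : ℕ} → (v : Fin n) → (e : Edge n) → _
v ∈ₑ? e = (v ≟ proj₁ e) ⊎-dec (v ≟ proj₂ e)

EV₀ : {n : ℕ} → Graph n → Subset n → List (Edge n)
EV₀ G V₀ = filter (λ e → (proj₁ e ∈? V₀) ⊎-dec (proj₂ e ∈? V₀)) (edges G)

s : {n k : ℕ} → List (Edge n) → (Edge n → Fin k) → Fin n → ℕ
s E₁ f v = sum (map (λ e → toℕ (f e)) (filter (v ∈ₑ?_) E₁))

colourCount : {n k : ℕ} → List (Edge n) → (Edge n → Fin k) → Fin k → ℕ
colourCount E₁ f c = Data.List.length (filter (λ e → f e ≟ c) E₁)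

-- Colour the edges at V₀ by removing vertices from V₀ one at a time. When some vertex u of the
-- current set C has edges leaving C, those edges are coloured last, with consecutive terms of
-- the sequence 1, 2m, 2, 2m-1, …, m, m+1, 0 (period k = 2m+1, successive pairs summing to k),
-- except for one edge which takes the residue that balances u. Apart from a balanced use of the
-- sequence, each removed vertex thus costs at most one extra edge per colour. If no edge leaves
-- C, then either C is bipartite, and any one vertex of C is balanced as soon as the others are
-- (both sides see the same total), or C contains a chordless odd cycle; its edges are exactly
-- the edges lost by removing its vertices, one per vertex, and they can be coloured to balance
-- every vertex of the cycle because 2 is invertible modulo the odd number k.
module Submission where

open import Defs
open import Algebra.Bundles using (CommutativeRing)
import Algebra.Solver.CommutativeMonoid as CommutativeMonoidSolver
open import Data.Bool using (Bool; true; false; not; _xor_) renaming (_≟_ to _≟ᵇ_)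
open import Data.Bool.Properties using (not-¬; not-injective; not-distribˡ-xor; xor-same; xor-assoc; xor-identityʳ; xor-∧-commutativeRing)
open import Data.Empty using (⊥-elim)
open import Data.Fin using (Fin; zero; suc; toℕ; fromℕ<; _≟_)
open import Data.Fin.Properties using (toℕ<n; toℕ-injective; toℕ-fromℕ<; punchInᵢ≢i)
open import Data.Fin.Subset using (Subset; _∈_; _∉_; ∣_∣; _-_; Nonempty; Empty)
open import Data.Fin.Subset.Properties using (_∈?_; p─q⊆p; x∈p∧x≢y⇒x∈p-y; x∈p⇒∣p-x∣<∣p∣; nonempty?)
open import Data.List using (List; []; _∷_; filter; length; _++_; map)
open import Data.List.Properties using (filter-none; length-++)
open import Data.List.Membership.Propositional using (find) renaming (_∈_ to _∈ₗ_; _∉_ to _∉ₗ_)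
open import Data.List.Membership.Propositional.Properties using (∈-filter⁻; ∈-filter⁺; ∈-++⁻; ∈-++⁺ˡ; ∈-++⁺ʳ; ∈-∃++)
import Data.List.Membership.DecPropositional as DecMembership
open import Data.List.Relation.Unary.Any using (Any; here; there; any?)
open import Data.List.Relation.Unary.All using (All; []; _∷_; tabulate)
import Data.List.Relation.Unary.All as All
open import Data.List.Relation.Unary.All.Properties using (¬Any⇒All¬)
open import Data.List.Relation.Unary.AllPairs using ([]; _∷_)
open import Data.List.Relation.Unary.Unique.Propositional using (Unique)
import Data.List.Relation.Unary.Unique.Propositional.Properties as Unique
open import Data.Nat using (ℕ; zero; suc; _+_; _*_; _∸_; _≤_; _<_; z≤n; s≤s; NonZero; >-nonZero⁻¹; _<?_; _≤?_)
open import Data.Nat.Properties hiding (_≟_)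
open import Data.Nat.DivMod using (_%_; m%n<n; m%n≤n; m%n%n≡m%n; %-distribˡ-+; n%n≡0; m<n⇒m%n≡m)
open import Data.Nat.Divisibility using (_∣_; divides; ∣m∣n⇒∣m+n; ∣m+n∣m⇒∣n; ∣n⇒∣m*n; n∣m*n; ∣⇒≤; m%n≡0⇒n∣m; n∣m⇒m%n≡0)
open import Data.Nat.ListAction using () renaming (sum to sumₗ)
open import Data.Nat.Solver using (module +-*-Solver)
open import Data.Product using (Σ; ∃; ∃₂; _×_; _,_; proj₁; proj₂; uncurry)
open import Data.Product.Properties using (≡-dec)
open import Data.Sum using (_⊎_; inj₁; inj₂; [_,_]′)
open import Data.Vec using (_∷_; here; there)
open import Data.Vec.Functional using (removeAt)
open import Function using (_∘_)
open import Level using (0ℓ)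
open import Relation.Binary.Bundles using (Setoid)
open import Relation.Binary.Structures using (IsEquivalence)
import Relation.Binary.Reasoning.Setoid as SetoidReasoning
open import Relation.Binary.PropositionalEquality
open import Relation.Nullary using (Dec; yes; no; ¬_)
open import Relation.Nullary.Decidable using (_×-dec_; _⊎-dec_; ¬?)
open import Relation.Unary using (Pred; Decidable)
open import Algebra.Properties.Semiring.Sum +-*-semiring
  using (sum-syntax; sum-cong-≗; ∑-distrib-+; *-distribʳ-sum; sum-remove; sum-replicate-zero) renaming (sum to ∑)
open +-*-Solver using (_:+_; _:*_; _:=_; con) renaming (solve to ℕ-solve)
open CommutativeRing xor-∧-commutativeRing using () renaming (+-commutativeMonoid to xor-commutativeMonoid)
open CommutativeMonoidSolver xor-commutativeMonoid using (_⊕_; _⊜_) renaming (solve to xor-solve)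

module Residues (k : ℕ) .{{_ : NonZero k}} where

  complement : ℕ → Fin k
  complement R = fromℕ< (m%n<n (k ∸ R % k) k)

  complement-∣ : ∀ R → k ∣ R + toℕ (complement R)
  complement-∣ R rewrite toℕ-fromℕ< (m%n<n (k ∸ R % k) k) = m%n≡0⇒n∣m _ _ (begin
    (R + (k ∸ r) % k) % k      ≡⟨ %-distribˡ-+ R ((k ∸ r) % k) k ⟩
    (r + (k ∸ r) % k % k) % k  ≡⟨ cong (λ z → (r + z) % k) (m%n%n≡m%n (k ∸ r) k) ⟩
    (r + (k ∸ r) % k) % k      ≡⟨ cong (λ z → (z + (k ∸ r) % k) % k) (sym (m%n%n≡m%n R k)) ⟩
    (r % k + (k ∸ r) % k) % k  ≡⟨ sym (%-distribˡ-+ r (k ∸ r) k) ⟩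
    (r + (k ∸ r)) % k          ≡⟨ cong (_% k) (m+[n∸m]≡n (m%n≤n R k)) ⟩
    k % k                      ≡⟨ n%n≡0 k ⟩
    0                          ∎)
    where
    open ≡-Reasoning
    r = R % k

  ∣∧<⇒≡0 : ∀ {x} → k ∣ x → x < k → x ≡ 0
  ∣∧<⇒≡0 {zero}  _   _   = refl
  ∣∧<⇒≡0 {suc x} k∣x x<k = ⊥-elim (<⇒≱ x<k (∣⇒≤ k∣x))

  residue-unique-≤ : ∀ R {a b} → a ≤ b → b < k → k ∣ R + a → k ∣ R + b → a ≡ b
  residue-unique-≤ R {a} {b} a≤b b<k k∣R+a k∣R+b =
    ≤-antisym a≤b (m∸n≡0⇒m≤n (∣∧<⇒≡0 k∣b∸a (≤-<-trans (m∸n≤m b a) b<k)))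
    where
    R+b≡R+a+[b∸a] : R + b ≡ R + a + (b ∸ a)
    R+b≡R+a+[b∸a] = trans (cong (R +_) (sym (m+[n∸m]≡n a≤b))) (sym (+-assoc R a (b ∸ a)))
    k∣b∸a : k ∣ b ∸ a
    k∣b∸a = ∣m+n∣m⇒∣n (subst (k ∣_) R+b≡R+a+[b∸a] k∣R+b) k∣R+a

  residue-unique : ∀ R {a b} → a < k → b < k → k ∣ R + a → k ∣ R + b → a ≡ b
  residue-unique R {a} {b} a<k b<k k∣R+a k∣R+b with ≤-total a b
  ... | inj₁ a≤b = residue-unique-≤ R a≤b b<k k∣R+a k∣R+b
  ... | inj₂ b≤a = sym (residue-unique-≤ R b≤a a<k k∣R+b k∣R+a)

  infix 4 _≈_
  record _≈_ (a b : ℕ) : Set where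
    constructor mk≈
    field ≈⇒%≡ : a % k ≡ b % k

  ≈-isEquivalence : IsEquivalence _≈_
  ≈-isEquivalence = record
    { refl  = mk≈ refl
    ; sym   = λ (mk≈ p) → mk≈ (sym p)
    ; trans = λ (mk≈ p) (mk≈ q) → mk≈ (trans p q)
    }

  ≈-setoid : Setoid 0ℓ 0ℓ
  ≈-setoid = record { isEquivalence = ≈-isEquivalence }

  open IsEquivalence ≈-isEquivalence public
    using () renaming (refl to ≈-refl; sym to ≈-sym; trans to ≈-trans)

  ≡⇒≈ : ∀ {a b} → a ≡ b → a ≈ b
  ≡⇒≈ refl = ≈-refl

  +-cong-≈ : ∀ {a b c d} → a ≈ b → c ≈ d → a + c ≈ b + d
  +-cong-≈ {a} {b} {c} {d} (mk≈ p) (mk≈ q) =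
    mk≈ (trans (%-distribˡ-+ a c k) (trans (cong₂ (λ x y → (x + y) % k) p q) (sym (%-distribˡ-+ b d k))))

  %-≈ : ∀ a → a % k ≈ a
  %-≈ a = mk≈ (m%n%n≡m%n a k)

  ∣⇒≈0 : ∀ {a} → k ∣ a → a ≈ 0
  ∣⇒≈0 {a} k∣a = mk≈ (trans (n∣m⇒m%n≡0 a k k∣a) (sym (m<n⇒m%n≡m (>-nonZero⁻¹ k))))

  ≈0⇒∣ : ∀ {a} → a ≈ 0 → k ∣ a
  ≈0⇒∣ {a} (mk≈ p) = m%n≡0⇒n∣m a k (trans p (m<n⇒m%n≡m (>-nonZero⁻¹ k)))

  complement-≈ : ∀ R → R + toℕ (complement R) ≈ 0
  complement-≈ R = ∣⇒≈0 (complement-∣ R)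

  +-cancelʳ-≈ : ∀ {a b} t → a + t ≈ b + t → a ≈ b
  +-cancelʳ-≈ {a} {b} t a+t≈b+t = begin
    a                ≈⟨ ≡⇒≈ (sym (+-identityʳ a)) ⟩
    a + 0            ≈⟨ +-cong-≈ (≈-refl {a}) (≈-sym (complement-≈ t)) ⟩
    a + (t + t′)     ≈⟨ ≡⇒≈ (sym (+-assoc a t t′)) ⟩
    a + t + t′       ≈⟨ +-cong-≈ a+t≈b+t (≈-refl {t′}) ⟩
    b + t + t′       ≈⟨ ≡⇒≈ (+-assoc b t t′) ⟩
    b + (t + t′)     ≈⟨ +-cong-≈ (≈-refl {b}) (complement-≈ t) ⟩
    b + 0            ≈⟨ ≡⇒≈ (+-identityʳ b) ⟩
    b                ∎
    where
    open SetoidReasoning ≈-setoid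
    t′ = toℕ (complement t)

  complement-shift : ∀ R x → toℕ (complement (R + x)) + x ≈ toℕ (complement R)
  complement-shift R x = +-cancelʳ-≈ R (begin
    toℕ (complement (R + x)) + x + R   ≡⟨ ℕ-solve 3 (λ c x r → c :+ x :+ r := r :+ x :+ c) refl (toℕ (complement (R + x))) x R ⟩
    R + x + toℕ (complement (R + x))   ≈⟨ complement-≈ (R + x) ⟩
    0                                    ≈⟨ ≈-sym (complement-≈ R) ⟩
    R + toℕ (complement R)             ≡⟨ +-comm R _ ⟩
    toℕ (complement R) + R             ∎)
    where open SetoidReasoning ≈-setoid

double : ℕ → ℕ
double zero    = zero
double (suc t) = suc (suc (double t))

double≡t+t : ∀ t → double t ≡ t + t
double≡t+t zero    = refl
double≡t+t (suc t) = cong suc (trans (cong suc (double≡t+t t)) (sym (+-suc t t)))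

double≡2* : ∀ t → double t ≡ 2 * t
double≡2* t = trans (double≡t+t t) (cong (t +_) (sym (+-identityʳ t)))

n≤double : ∀ t → t ≤ double t
n≤double t = subst (t ≤_) (sym (double≡t+t t)) (m≤m+n t t)

double-mono-≤ : ∀ {a b} → a ≤ b → double a ≤ double b
double-mono-≤ {zero}  _         = z≤n
double-mono-≤ {suc a} (s≤s a≤b) = s≤s (s≤s (double-mono-≤ a≤b))

double-cancel-≤ : ∀ {a b} → double a ≤ double b → a ≤ b
double-cancel-≤ {zero}              _               = z≤n
double-cancel-≤ {suc a} {suc b} (s≤s (s≤s 2a≤2b)) = s≤s (double-cancel-≤ 2a≤2b)

odd≤double⇒< : ∀ {a b} → suc (double a) ≤ double b → a < b
odd≤double⇒< {zero}  {suc b} _                    = s≤s z≤n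
odd≤double⇒< {suc a} {suc b} (s≤s (s≤s 2a+1≤2b)) = s≤s (odd≤double⇒< 2a+1≤2b)

data Parity : ℕ → Set where
  even : ∀ t → Parity (double t)
  odd  : ∀ t → Parity (suc (double t))

parity : ∀ j → Parity j
parity zero          = even 0
parity (suc zero)    = odd 0
parity (suc (suc j)) with parity j
... | even t = even (suc t)
... | odd t  = odd (suc t)

alternate : (ℕ → ℕ) → (ℕ → ℕ) → ℕ → ℕ
alternate f g zero          = f 0
alternate f g (suc zero)    = g 0
alternate f g (suc (suc j)) = alternate (f ∘ suc) (g ∘ suc) j

alternate-even : ∀ f g t → alternate f g (double t) ≡ f t
alternate-even f g zero    = refl
alternate-even f g (suc t) = alternate-even (f ∘ suc) (g ∘ suc) t

alternate-odd : ∀ f g t → alternate f g (suc (double t)) ≡ g t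
alternate-odd f g zero    = refl
alternate-odd f g (suc t) = alternate-odd (f ∘ suc) (g ∘ suc) t

indicator : ∀ {a} {A : Set a} → Dec A → ℕ
indicator (yes _) = 1
indicator (no _)  = 0

indicator-yes : ∀ {a} {A : Set a} (d : Dec A) → A → indicator d ≡ 1
indicator-yes (yes _) _ = refl
indicator-yes (no ¬a) a = ⊥-elim (¬a a)

indicator-no : ∀ {a} {A : Set a} (d : Dec A) → ¬ A → indicator d ≡ 0
indicator-no (yes a) ¬a = ⊥-elim (¬a a)
indicator-no (no _)  _  = refl

indicator≤1 : ∀ {a} {A : Set a} (d : Dec A) → indicator d ≤ 1
indicator≤1 (yes _) = ≤-refl
indicator≤1 (no _)  = z≤n

-- term j is the j-th entry of 1, 2m, 2, 2m-1, …, m, m+1, 0, 1, 2m, … (period k = 2m+1): each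
-- colour occurs once per period, and the terms at offsets 2t, 2t+1 (t < m) sum to k.
module PairedSequence (m : ℕ) where

  k : ℕ
  k = suc (double m)

  open Residues k public

  low : ℕ → ℕ
  low t with t <? m
  ... | yes _ = suc t
  ... | no _  = 0

  high : ℕ → ℕ
  high t = k ∸ suc t

  term : ℕ → ℕ
  term = alternate low high

  term-even : ∀ t → term (double t) ≡ low t
  term-even = alternate-even low high

  term-odd : ∀ t → term (suc (double t)) ≡ high t
  term-odd = alternate-odd low high

  low-< : ∀ {t} → t < m → low t ≡ suc t
  low-< {t} t<m with t <? m
  ... | yes _   = refl
  ... | no t≮m = ⊥-elim (t≮m t<m)

  low-m : low m ≡ 0
  low-m with m <? m
  ... | yes m<m = ⊥-elim (<-irrefl refl m<m)
  ... | no _    = refl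

  low≤m : ∀ t → low t ≤ m
  low≤m t with t <? m
  ... | yes t<m = t<m
  ... | no _    = z≤n

  term<k : ∀ j → term j < k
  term<k j with parity j
  ... | even t = subst (_< k) (sym (term-even t)) (s≤s (≤-trans (low≤m t) (n≤double m)))
  ... | odd t  = subst (_< k) (sym (term-odd t)) (s≤s (m∸n≤m (double m) t))

  even-offset<k⇒≤m : ∀ {t} → double t < k → t ≤ m
  even-offset<k⇒≤m 2t<k = double-cancel-≤ (≤-pred 2t<k)

  odd-offset<k⇒<m : ∀ {t} → suc (double t) < k → t < m
  odd-offset<k⇒<m 2t+1<k = odd≤double⇒< (≤-pred 2t+1<k)

  index : ℕ → ℕ
  index zero = double m
  index (suc y) with suc y ≤? m
  ... | yes _ = double y
  ... | no _  = suc (double (double m ∸ suc y))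

  index-low : ∀ {y} → suc y ≤ m → index (suc y) ≡ double y
  index-low {y} y<m with suc y ≤? m
  ... | yes _   = refl
  ... | no y≮m = ⊥-elim (y≮m y<m)

  index-high : ∀ {y} → ¬ (suc y ≤ m) → index (suc y) ≡ suc (double (double m ∸ suc y))
  index-high {y} y≮m with suc y ≤? m
  ... | yes y<m = ⊥-elim (y≮m y<m)
  ... | no _    = refl

  high≡suc : ∀ {t} → t < m → high t ≡ suc (double m ∸ suc t)
  high≡suc t<m = +-∸-assoc 1 (≤-trans t<m (n≤double m))

  index-term : ∀ j → j < k → index (term j) ≡ j
  index-term j j<k with parity j
  ... | even t with t <? m
  ...   | yes t<m = trans (cong index (trans (term-even t) (low-< t<m))) (index-low t<m)
  ...   | no t≮m = trans (cong index (trans (term-even t) (trans (cong low t≡m) low-m))) (cong double (sym t≡m))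
    where
    t≡m : t ≡ m
    t≡m = ≤-antisym (even-offset<k⇒≤m j<k) (≮⇒≥ t≮m)
  index-term j j<k | odd t = begin
    index (term (suc (double t)))            ≡⟨ cong index (trans (term-odd t) (high≡suc t<m)) ⟩
    index (suc (double m ∸ suc t))           ≡⟨ index-high high-t≰m ⟩
    suc (double (double m ∸ suc (double m ∸ suc t))) ≡⟨ cong (λ z → suc (double (double m ∸ z))) (sym (high≡suc t<m)) ⟩
    suc (double (double m ∸ (double m ∸ t))) ≡⟨ cong (λ z → suc (double z)) (m∸[m∸n]≡n (≤-trans (<⇒≤ t<m) (n≤double m))) ⟩
    suc (double t)                           ∎
    where
    open ≡-Reasoning
    t<m : t < m
    t<m = odd-offset<k⇒<m j<k
    high-t≰m : ¬ (suc (double m ∸ suc t) ≤ m)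
    high-t≰m high-t≤m = <⇒≱ t<m (+-cancelˡ-≤ m m t m+m≤m+t)
      where
      m+m≤m+t : m + m ≤ m + t
      m+m≤m+t = subst₂ _≤_ (double≡t+t m) (+-comm t m)
        (≤-trans (m≤n+m∸n (double m) t) (+-monoʳ-≤ t (subst (_≤ m) (sym (high≡suc t<m)) high-t≤m)))

  term-index : ∀ x → x < k → term (index x) ≡ x
  term-index zero _ = trans (term-even m) low-m
  term-index (suc y) y<2m with suc y ≤? m
  ... | yes y<m = trans (term-even y) (low-< y<m)
  ... | no _    = trans (term-odd (double m ∸ suc y)) (m∸[m∸n]≡n (≤-pred y<2m))

  index≤2m : ∀ x → x < k → index x ≤ double m
  index≤2m zero _ = ≤-refl
  index≤2m (suc y) y<2m with suc y ≤? m
  ... | yes y<m = double-mono-≤ (≤-trans (n≤1+n y) y<m)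
  ... | no y≮m  = ≤-trans (n≤1+n _) (double-mono-≤ {suc z} z<m)
    where
    z = double m ∸ suc y
    z<m : z < m
    z<m = +-cancelʳ-< (suc y) z m (subst (_< m + suc y) (sym (trans (m∸n+n≡m (≤-pred y<2m)) (double≡t+t m))) (+-monoʳ-< m (≰⇒> y≮m)))

  termᶠ : ℕ → Fin k
  termᶠ j = fromℕ< (term<k j)

  indexᶠ : Fin k → ℕ
  indexᶠ c = index (toℕ c)

  termᶠ⇒indexᶠ : ∀ {j c} → j < k → termᶠ j ≡ c → indexᶠ c ≡ j
  termᶠ⇒indexᶠ {j} j<k refl = trans (cong index (toℕ-fromℕ< (term<k j))) (index-term j j<k)

  indexᶠ⇒termᶠ : ∀ {j c} → indexᶠ c ≡ j → termᶠ j ≡ c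
  indexᶠ⇒termᶠ {c = c} refl = toℕ-injective (trans (toℕ-fromℕ< (term<k (indexᶠ c))) (term-index (toℕ c) (toℕ<n c)))

  halve : ℕ → ℕ
  halve g = (g * suc m) % k

  halve-+-halve : ∀ g → halve g + halve g ≈ g
  halve-+-halve g = begin
    halve g + halve g            ≈⟨ +-cong-≈ (%-≈ (g * suc m)) (%-≈ (g * suc m)) ⟩
    g * suc m + g * suc m        ≡⟨ sym (*-distribˡ-+ g (suc m) (suc m)) ⟩
    g * (suc m + suc m)          ≡⟨ cong (λ z → g * suc z) (trans (+-suc m m) (cong suc (sym (double≡t+t m)))) ⟩
    g * suc k                    ≡⟨ *-suc g k ⟩
    g + g * k                    ≈⟨ +-cong-≈ (≈-refl {g}) (∣⇒≈0 (n∣m*n g)) ⟩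
    g + 0                        ≡⟨ +-identityʳ g ⟩
    g                            ∎
    where open SetoidReasoning ≈-setoid

  halveᶠ : ℕ → Fin k
  halveᶠ g = fromℕ< (m%n<n (g * suc m) k)

  toℕ-halveᶠ : ∀ g → toℕ (halveᶠ g) ≡ halve g
  toℕ-halveᶠ g = toℕ-fromℕ< (m%n<n (g * suc m) k)

  record Cursor : Set where
    constructor cursor
    field
      laps offset : ℕ
      offset<k    : offset < k
  open Cursor public

  origin : Cursor
  origin = cursor 0 0 (s≤s z≤n)

  consumed : Cursor → ℕ
  consumed s = laps s * k + offset s

  current : Cursor → Fin k
  current s = termᶠ (offset s)

  toℕ-current : ∀ s → toℕ (current s) ≡ term (offset s)
  toℕ-current s = toℕ-fromℕ< (term<k (offset s))

  advance : Cursor → Cursor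
  advance (cursor q j j<k) with suc j <? k
  ... | yes j+1<k = cursor q (suc j) j+1<k
  ... | no _      = cursor (suc q) 0 (s≤s z≤n)

  last-offset : ∀ {j} → j < k → ¬ (suc j < k) → j ≡ double m
  last-offset j<k j+1≮k = ≤-antisym (≤-pred j<k) (≤-pred (≮⇒≥ j+1≮k))

  consumed-advance : ∀ s → consumed (advance s) ≡ suc (consumed s)
  consumed-advance (cursor q j j<k) with suc j <? k
  ... | yes _     = +-suc (q * k) j
  ... | no j+1≮k = begin
    k + q * k + 0           ≡⟨ +-identityʳ _ ⟩
    k + q * k               ≡⟨ +-comm k (q * k) ⟩
    q * k + suc (double m)  ≡⟨ +-suc (q * k) (double m) ⟩
    suc (q * k + double m)  ≡⟨ cong (λ z → suc (q * k + z)) (sym (last-offset j<k j+1≮k)) ⟩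
    suc (q * k + j)         ∎
    where open ≡-Reasoning

  occurrences : Fin k → Cursor → ℕ
  occurrences c s = laps s + indicator (indexᶠ c <? offset s)

  occurrences-advance : ∀ c s → occurrences c (advance s) ≡ occurrences c s + indicator (current s ≟ c)
  occurrences-advance c (cursor q j j<k) with suc j <? k
  ... | yes _ with indexᶠ c <? j | indexᶠ c <? suc j | termᶠ j ≟ c
  ...   | yes i<j | _        | yes j↦c = ⊥-elim (<-irrefl (termᶠ⇒indexᶠ j<k j↦c) i<j)
  ...   | yes _   | yes _    | no _    = sym (+-identityʳ _)
  ...   | yes i<j | no i≮j+1 | _       = ⊥-elim (i≮j+1 (m≤n⇒m≤1+n i<j))
  ...   | no _    | yes _    | yes _   = cong (_+ 1) (sym (+-identityʳ q))
  ...   | no i≮j  | yes i<j+1 | no j↦̸c = ⊥-elim (j↦̸c (indexᶠ⇒termᶠ (≤-antisym (≤-pred i<j+1) (≮⇒≥ i≮j))))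
  ...   | no _    | no i≮j+1 | yes j↦c = ⊥-elim (i≮j+1 (s≤s (≤-reflexive (termᶠ⇒indexᶠ j<k j↦c))))
  ...   | no _    | no _     | no _    = sym (+-identityʳ _)
  occurrences-advance c (cursor q j j<k) | no j+1≮k
    rewrite indicator-no (indexᶠ c <? 0) (λ ()) with indexᶠ c <? j | termᶠ j ≟ c
  ... | yes i<j | yes j↦c = ⊥-elim (<-irrefl (termᶠ⇒indexᶠ j<k j↦c) i<j)
  ... | yes _   | no _    = trans (+-identityʳ (suc q)) (trans (+-comm 1 q) (sym (+-identityʳ _)))
  ... | no _    | yes _   = trans (+-identityʳ (suc q)) (trans (+-comm 1 q) (cong (_+ 1) (sym (+-identityʳ q))))
  ... | no i≮j  | no j↦̸c = ⊥-elim (j↦̸c (indexᶠ⇒termᶠ (≤-antisym i≤j (≮⇒≥ i≮j))))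
    where
    i≤j : indexᶠ c ≤ j
    i≤j = ≤-trans (index≤2m (toℕ c) (toℕ<n c)) (≤-reflexive (sym (last-offset j<k j+1≮k)))

  occurrences-origin : ∀ c → occurrences c origin ≡ 0
  occurrences-origin c = indicator-no (indexᶠ c <? 0) λ ()

  occurrences-bound : ∀ c s → k * occurrences c s ≤ consumed s + double m
  occurrences-bound c (cursor q j j<k) with indexᶠ c <? j
  ... | yes i<j = begin
    k * (q + 1)         ≡⟨ trans (*-distribˡ-+ k q 1) (cong₂ _+_ (*-comm k q) (*-identityʳ k)) ⟩
    q * k + k           ≤⟨ +-monoʳ-≤ (q * k) (+-monoˡ-≤ (double m) (≤-trans (s≤s z≤n) i<j)) ⟩
    q * k + (j + double m) ≡⟨ sym (+-assoc (q * k) j (double m)) ⟩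
    q * k + j + double m ∎
    where open ≤-Reasoning
  ... | no _ = begin
    k * (q + 0)          ≡⟨ trans (cong (k *_) (+-identityʳ q)) (*-comm k q) ⟩
    q * k                ≤⟨ m≤m+n (q * k) (j + double m) ⟩
    q * k + (j + double m) ≡⟨ sym (+-assoc (q * k) j (double m)) ⟩
    q * k + j + double m ∎
    where open ≤-Reasoning

  occurrences-zero-bound : ∀ s → k * occurrences zero s ≤ consumed s
  occurrences-zero-bound (cursor q j j<k) with double m <? j
  ... | yes 2m<j = ⊥-elim (<⇒≱ 2m<j (≤-pred j<k))
  ... | no _     = begin
    k * (q + 0)  ≡⟨ trans (cong (k *_) (+-identityʳ q)) (*-comm k q) ⟩
    q * k        ≤⟨ m≤m+n (q * k) j ⟩
    q * k + j    ∎
    where open ≤-Reasoning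

  -- At an odd offset the last term used still awaits its partner, the next term; Settled s S says
  -- that S becomes a multiple of k once that partner is added.
  unpaired : ℕ → ℕ
  unpaired = alternate (λ _ → 0) high

  Settled : Cursor → ℕ → Set
  Settled s S = k ∣ S + unpaired (offset s)

  settled-origin : Settled origin 0
  settled-origin = divides 0 refl

  offset-advance : ∀ s → (suc (offset s) < k × offset (advance s) ≡ suc (offset s))
                         ⊎ (¬ (suc (offset s) < k) × offset (advance s) ≡ 0)
  offset-advance (cursor q j j<k) with suc j <? k
  ... | yes j+1<k = inj₁ (j+1<k , refl)
  ... | no j+1≮k  = inj₂ (j+1≮k , refl)

  unpaired-even : ∀ t → unpaired (double t) ≡ 0
  unpaired-even = alternate-even (λ _ → 0) high

  unpaired-odd : ∀ t → unpaired (suc (double t)) ≡ high t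
  unpaired-odd = alternate-odd (λ _ → 0) high

  settled-next : ∀ j S → suc j < k → k ∣ S + unpaired j → k ∣ S + term j + unpaired (suc j)
  settled-next j S j+1<k k∣S+u with parity j
  ... | even t rewrite term-even t | unpaired-odd t | low-< (odd-offset<k⇒<m j+1<k) | unpaired-even t =
    subst (k ∣_) S+k≡S+[t+1]+high (∣m∣n⇒∣m+n (subst (k ∣_) (+-identityʳ S) k∣S+u) (divides 1 (sym (+-identityʳ k))))
    where
    S+k≡S+[t+1]+high : S + k ≡ S + suc t + high t
    S+k≡S+[t+1]+high = trans (cong (S +_) (sym (m+[n∸m]≡n (≤-trans (odd-offset<k⇒<m j+1<k) (≤-trans (n≤double m) (n≤1+n _))))))
                              (sym (+-assoc S (suc t) (high t)))
  ... | odd t rewrite term-odd t | unpaired-odd t | unpaired-even (suc t) = subst (k ∣_) (sym (+-identityʳ _)) k∣S+u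

  settled-wrap : ∀ j S → j < k → ¬ (suc j < k) → k ∣ S + unpaired j → k ∣ S + term j + unpaired 0
  settled-wrap j S j<k j+1≮k k∣S+u rewrite last-offset j<k j+1≮k | term-even m | low-m | unpaired-even m = subst (k ∣_) (sym (+-identityʳ _)) k∣S+u

  settled-advance : ∀ s S → Settled s S → Settled (advance s) (S + toℕ (current s))
  settled-advance s S k∣S+u with offset-advance s
  ... | inj₁ (j+1<k , j′≡j+1) rewrite j′≡j+1 | toℕ-current s = settled-next (offset s) S j+1<k k∣S+u
  ... | inj₂ (j+1≮k , j′≡0)   rewrite j′≡0 | toℕ-current s = settled-wrap (offset s) S (offset<k s) j+1≮k k∣S+u

  unpaired<k : ∀ j → unpaired j < k
  unpaired<k j with parity j
  ... | even t = subst (_< k) (sym (unpaired-even t)) (s≤s z≤n)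
  ... | odd t  = subst (_< k) (sym (unpaired-odd t)) (s≤s (m∸n≤m (double m) t))

  complement-settled : ∀ s S → Settled s S → toℕ (complement S) ≡ 0 ⊎ complement S ≡ current s
  complement-settled s S k∣S+u with parity (offset s) | residue-unique S (toℕ<n (complement S)) (unpaired<k (offset s)) (complement-∣ S) k∣S+u
  ... | even t | c≡u = inj₁ (trans c≡u (unpaired-even t))
  ... | odd t  | c≡u = inj₂ (toℕ-injective (trans c≡u (trans (unpaired-odd t) (trans (sym (term-odd t)) (sym (toℕ-current s))))))

  occurrences-budget : ∀ c s → k * occurrences c s + k * indicator (c ≟ zero) ≤ consumed s + k
  occurrences-budget c s with c ≟ zero
  ... | yes refl = +-mono-≤ (occurrences-zero-bound s) (≤-reflexive (*-identityʳ k))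
  ... | no _     = begin
    k * occurrences c s + k * 0   ≡⟨ cong (k * occurrences c s +_) (*-zeroʳ k) ⟩
    k * occurrences c s + 0       ≡⟨ +-identityʳ _ ⟩
    k * occurrences c s           ≤⟨ occurrences-bound c s ⟩
    consumed s + double m         ≤⟨ +-monoʳ-≤ (consumed s) (n≤1+n (double m)) ⟩
    consumed s + k                ∎
    where open ≤-Reasoning

_≟ₑ_ : ∀ {n} (x y : Edge n) → Dec (x ≡ y)
_≟ₑ_ = ≡-dec _≟_ _≟_

∉-∷⁻ : ∀ {a} {A : Set a} {x : A} {xs} → Unique (x ∷ xs) → x ∉ₗ xs
∉-∷⁻ (x∉ ∷ _) x∈ = All.lookup x∉ x∈ refl

module _ {n k : ℕ} where

  s-∷ : ∀ x xs (f : Edge n → Fin k) v → s (x ∷ xs) f v ≡ indicator (v ∈ₑ? x) * toℕ (f x) + s xs f v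
  s-∷ x xs f v with v ≟ proj₁ x | v ≟ proj₂ x
  ... | yes _ | _     = cong (_+ s xs f v) (sym (+-identityʳ _))
  ... | no _  | yes _ = cong (_+ s xs f v) (sym (+-identityʳ _))
  ... | no _  | no _  = refl

  colourCount-∷ : ∀ x xs (f : Edge n → Fin k) c → colourCount (x ∷ xs) f c ≡ indicator (f x ≟ c) + colourCount xs f c
  colourCount-∷ x xs f c with f x ≟ c
  ... | yes _ = refl
  ... | no _  = refl

  s-cong : ∀ E (f g : Edge n → Fin k) v → (∀ {x} → x ∈ₗ E → f x ≡ g x) → s E f v ≡ s E g v
  s-cong []      f g v f≗g = refl
  s-cong (x ∷ E) f g v f≗g = begin
    s (x ∷ E) f v                                  ≡⟨ s-∷ x E f v ⟩
    indicator (v ∈ₑ? x) * toℕ (f x) + s E f v      ≡⟨ cong₂ (λ a b → indicator (v ∈ₑ? x) * toℕ a + b) (f≗g (here refl)) (s-cong E f g v (f≗g ∘ there)) ⟩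
    indicator (v ∈ₑ? x) * toℕ (g x) + s E g v      ≡⟨ sym (s-∷ x E g v) ⟩
    s (x ∷ E) g v                                  ∎
    where open ≡-Reasoning

  colourCount-cong : ∀ E (f g : Edge n → Fin k) c → (∀ {x} → x ∈ₗ E → f x ≡ g x) → colourCount E f c ≡ colourCount E g c
  colourCount-cong []      f g c f≗g = refl
  colourCount-cong (x ∷ E) f g c f≗g = begin
    colourCount (x ∷ E) f c                        ≡⟨ colourCount-∷ x E f c ⟩
    indicator (f x ≟ c) + colourCount E f c        ≡⟨ cong₂ (λ a b → indicator (a ≟ c) + b) (f≗g (here refl)) (colourCount-cong E f g c (f≗g ∘ there)) ⟩
    indicator (g x ≟ c) + colourCount E g c        ≡⟨ sym (colourCount-∷ x E g c) ⟩
    colourCount (x ∷ E) g c                        ∎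
    where open ≡-Reasoning

  colourCount≤length : ∀ E (f : Edge n → Fin k) c → colourCount E f c ≤ length E
  colourCount≤length []      f c = z≤n
  colourCount≤length (x ∷ E) f c with f x ≟ c
  ... | yes _ = s≤s (colourCount≤length E f c)
  ... | no _  = m≤n⇒m≤1+n (colourCount≤length E f c)

  s-filter : ∀ {p} {P : Pred (Edge n) p} (P? : Decidable P) xs (f : Edge n → Fin k) v →
             (∀ {x} → v ∈ₑ x → P x) → s (filter P? xs) f v ≡ s xs f v
  s-filter P? []       f v v∈⇒P = refl
  s-filter P? (x ∷ xs) f v v∈⇒P with P? x
  ... | yes _ = trans (s-∷ x (filter P? xs) f v) (trans (cong (indicator (v ∈ₑ? x) * toℕ (f x) +_) (s-filter P? xs f v v∈⇒P)) (sym (s-∷ x xs f v)))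
  ... | no ¬Px = trans (s-filter P? xs f v v∈⇒P) (sym (trans (s-∷ x xs f v) (cong (λ i → i * toℕ (f x) + s xs f v) (indicator-no (v ∈ₑ? x) (¬Px ∘ v∈⇒P)))))

  infixl 6 _[_≔_]
  _[_≔_] : (Edge n → Fin k) → Edge n → Fin k → Edge n → Fin k
  (f [ e ≔ c ]) x with x ≟ₑ e
  ... | yes _ = c
  ... | no _  = f x

  [≔]-same : ∀ f e c → (f [ e ≔ c ]) e ≡ c
  [≔]-same f e c with e ≟ₑ e
  ... | yes _  = refl
  ... | no e≢e = ⊥-elim (e≢e refl)

  [≔]-other : ∀ f e c {x} → x ≢ e → (f [ e ≔ c ]) x ≡ f x
  [≔]-other f e c {x} x≢e with x ≟ₑ e
  ... | yes x≡e = ⊥-elim (x≢e x≡e)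
  ... | no _    = refl

  [≔]-∉ : ∀ f e c {E x} → e ∉ₗ E → x ∈ₗ E → (f [ e ≔ c ]) x ≡ f x
  [≔]-∉ f e c e∉E x∈E = [≔]-other f e c (λ { refl → e∉E x∈E })

module _ {n k : ℕ} where

  blank : Edge n → Fin (suc k)
  blank _ = zero

  s-blank : ∀ E v → s E blank v ≡ 0
  s-blank []      v = refl
  s-blank (x ∷ E) v = trans (s-∷ x E blank v) (trans (cong (_+ s E blank v) (*-zeroʳ (indicator (v ∈ₑ? x)))) (s-blank E v))

  colourCount-blank : ∀ E {c} → c ≢ zero → colourCount E blank c ≡ 0
  colourCount-blank []      c≢0 = refl
  colourCount-blank (x ∷ E) {c} c≢0 = trans (colourCount-∷ x E blank c) (trans (cong (_+ colourCount E blank c) (indicator-no (zero ≟ c) (c≢0 ∘ sym))) (colourCount-blank E c≢0))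

  s-[≔] : ∀ E (f : Edge n → Fin (suc k)) e c v → Unique E → e ∈ₗ E → f e ≡ zero →
          s E (f [ e ≔ c ]) v ≡ s E f v + indicator (v ∈ₑ? e) * toℕ c
  s-[≔] (x ∷ E) f .x c v (x∉ ∷ uE) (here refl) fx≡0 = begin
    s (x ∷ E) (f [ x ≔ c ]) v                                  ≡⟨ s-∷ x E (f [ x ≔ c ]) v ⟩
    i * toℕ ((f [ x ≔ c ]) x) + s E (f [ x ≔ c ]) v            ≡⟨ cong₂ (λ a b → i * toℕ a + b) ([≔]-same f x c) (s-cong E _ f v ([≔]-∉ f x c (∉-∷⁻ (x∉ ∷ uE)))) ⟩
    i * toℕ c + s E f v                                        ≡⟨ +-comm (i * toℕ c) (s E f v) ⟩
    s E f v + i * toℕ c                                        ≡⟨ cong (_+ i * toℕ c) (sym (+-identityˡ (s E f v))) ⟩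
    0 + s E f v + i * toℕ c                                    ≡⟨ cong (λ z → z + s E f v + i * toℕ c) (sym (trans (cong (λ a → i * toℕ a) fx≡0) (*-zeroʳ i))) ⟩
    i * toℕ (f x) + s E f v + i * toℕ c                        ≡⟨ cong (_+ i * toℕ c) (sym (s-∷ x E f v)) ⟩
    s (x ∷ E) f v + i * toℕ c                                  ∎
    where
    open ≡-Reasoning
    i = indicator (v ∈ₑ? x)
  s-[≔] (x ∷ E) f e c v (x∉ ∷ uE) (there e∈E) fe≡0 = begin
    s (x ∷ E) (f [ e ≔ c ]) v                                  ≡⟨ s-∷ x E (f [ e ≔ c ]) v ⟩
    i * toℕ ((f [ e ≔ c ]) x) + s E (f [ e ≔ c ]) v            ≡⟨ cong₂ (λ a b → i * toℕ a + b) ([≔]-other f e c x≢e) (s-[≔] E f e c v uE e∈E fe≡0) ⟩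
    i * toℕ (f x) + (s E f v + j * toℕ c)                      ≡⟨ sym (+-assoc (i * toℕ (f x)) (s E f v) (j * toℕ c)) ⟩
    i * toℕ (f x) + s E f v + j * toℕ c                        ≡⟨ cong (_+ j * toℕ c) (sym (s-∷ x E f v)) ⟩
    s (x ∷ E) f v + j * toℕ c                                  ∎
    where
    open ≡-Reasoning
    i = indicator (v ∈ₑ? x)
    j = indicator (v ∈ₑ? e)
    x≢e : x ≢ e
    x≢e refl = ∉-∷⁻ (x∉ ∷ uE) e∈E

module FilterSplit {a p q} {A : Set a} {P : Pred A p} {Q : Pred A q}
                   (P? : Decidable P) (Q? : Decidable Q) (Q⇒P : ∀ {x} → Q x → P x) where

  P∖Q? : Decidable (λ x → P x × ¬ Q x)
  P∖Q? x = P? x ×-dec ¬? (Q? x)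

  length-filter-split : ∀ xs → length (filter P? xs) ≡ length (filter Q? xs) + length (filter P∖Q? xs)
  length-filter-split [] = refl
  length-filter-split (x ∷ xs) with P? x | Q? x
  ... | yes _  | yes _  = cong suc (length-filter-split xs)
  ... | yes _  | no _   = trans (cong suc (length-filter-split xs)) (sym (+-suc (length (filter Q? xs)) _))
  ... | no ¬Px | yes Qx = ⊥-elim (¬Px (Q⇒P Qx))
  ... | no _   | no _   = length-filter-split xs

  length-filter-mono : ∀ xs → length (filter Q? xs) ≤ length (filter P? xs)
  length-filter-mono xs = ≤-trans (m≤m+n _ _) (≤-reflexive (sym (length-filter-split xs)))

  length-filter-filter-split : ∀ {r} {R : Pred A r} (R? : Decidable R) xs →
    length (filter R? (filter P? xs)) ≡ length (filter R? (filter Q? xs)) + length (filter R? (filter P∖Q? xs))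
  length-filter-filter-split R? [] = refl
  length-filter-filter-split R? (x ∷ xs) with P? x | Q? x
  ... | no ¬Px | yes Qx = ⊥-elim (¬Px (Q⇒P Qx))
  ... | no _   | no _   = length-filter-filter-split R? xs
  ... | yes _  | yes _ with R? x
  ...   | yes _ = cong suc (length-filter-filter-split R? xs)
  ...   | no _  = length-filter-filter-split R? xs
  length-filter-filter-split R? (x ∷ xs) | yes _ | no _ with R? x
  ...   | yes _ = trans (cong suc (length-filter-filter-split R? xs)) (sym (+-suc _ _))
  ...   | no _  = length-filter-filter-split R? xs

x∈p-y⇒x≢y : ∀ {n} {p : Subset n} {x y : Fin n} → x ∈ p - y → x ≢ y
x∈p-y⇒x≢y {p = _ ∷ p} (there x∈p-y) refl = x∈p-y⇒x≢y {p = p} x∈p-y refl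

x∈p⇒1≤∣p∣ : ∀ {n} {p : Subset n} {x} → x ∈ p → 1 ≤ ∣ p ∣
x∈p⇒1≤∣p∣ x∈p = ≤-trans (s≤s z≤n) (x∈p⇒∣p-x∣<∣p∣ x∈p)

_-ₗ_ : ∀ {n} → Subset n → List (Fin n) → Subset n
p -ₗ []       = p
p -ₗ (x ∷ xs) = (p - x) -ₗ xs

-ₗ-⊆ : ∀ {n} (p : Subset n) xs {v} → v ∈ p -ₗ xs → v ∈ p
-ₗ-⊆ p []       v∈ = v∈
-ₗ-⊆ p (x ∷ xs) v∈ = p─q⊆p p _ (-ₗ-⊆ (p - x) xs v∈)

∈-ₗ⇒∉ : ∀ {n} (p : Subset n) xs {v} → v ∈ p -ₗ xs → v ∉ₗ xs
∈-ₗ⇒∉ p (x ∷ xs) v∈ (here refl) = x∈p-y⇒x≢y (-ₗ-⊆ (p - x) xs v∈) refl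
∈-ₗ⇒∉ p (x ∷ xs) v∈ (there v∈xs) = ∈-ₗ⇒∉ (p - x) xs v∈ v∈xs

∈∧∉⇒∈-ₗ : ∀ {n} (p : Subset n) xs {v} → v ∈ p → v ∉ₗ xs → v ∈ p -ₗ xs
∈∧∉⇒∈-ₗ p []       v∈p _     = v∈p
∈∧∉⇒∈-ₗ p (x ∷ xs) v∈p v∉xs = ∈∧∉⇒∈-ₗ (p - x) xs (x∈p∧x≢y⇒x∈p-y v∈p (v∉xs ∘ here)) (v∉xs ∘ there)

∣-ₗ∣+length≤ : ∀ {n} (p : Subset n) xs → Unique xs → (∀ {v} → v ∈ₗ xs → v ∈ p) → ∣ p -ₗ xs ∣ + length xs ≤ ∣ p ∣
∣-ₗ∣+length≤ p []       _           _      = ≤-reflexive (+-identityʳ _)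
∣-ₗ∣+length≤ p (x ∷ xs) (x∉ ∷ uxs) xs⊆p = begin
  ∣ (p - x) -ₗ xs ∣ + suc (length xs)  ≡⟨ +-suc _ (length xs) ⟩
  suc (∣ (p - x) -ₗ xs ∣ + length xs)  ≤⟨ s≤s (∣-ₗ∣+length≤ (p - x) xs uxs xs⊆p-x) ⟩
  suc ∣ p - x ∣                        ≤⟨ x∈p⇒∣p-x∣<∣p∣ (xs⊆p (here refl)) ⟩
  ∣ p ∣                                ∎
  where
  open ≤-Reasoning
  xs⊆p-x : ∀ {v} → v ∈ₗ xs → v ∈ p - x
  xs⊆p-x v∈xs = x∈p∧x≢y⇒x∈p-y (xs⊆p (there v∈xs)) (λ { refl → All.lookup x∉ v∈xs refl })

Unique-⊆⇒length≤ : ∀ {a} {A : Set a} (xs ys : List A) → Unique xs → (∀ {x} → x ∈ₗ xs → x ∈ₗ ys) → length xs ≤ length ys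
Unique-⊆⇒length≤ []       ys _           _      = z≤n
Unique-⊆⇒length≤ (x ∷ xs) ys (x∉ ∷ uxs) xs⊆ys with ∈-∃++ (xs⊆ys (here refl))
... | as , bs , refl = begin
  suc (length xs)              ≤⟨ s≤s (Unique-⊆⇒length≤ xs (as ++ bs) uxs xs⊆as++bs) ⟩
  suc (length (as ++ bs))      ≡⟨ cong suc (length-++ as) ⟩
  suc (length as + length bs)  ≡⟨ sym (+-suc (length as) (length bs)) ⟩
  length as + length (x ∷ bs)  ≡⟨ sym (length-++ as) ⟩
  length (as ++ x ∷ bs)        ∎
  where
  open ≤-Reasoning
  xs⊆as++bs : ∀ {y} → y ∈ₗ xs → y ∈ₗ as ++ bs
  xs⊆as++bs {y} y∈xs with ∈-++⁻ as (xs⊆ys (there y∈xs))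
  ... | inj₁ y∈as          = ∈-++⁺ˡ y∈as
  ... | inj₂ (here refl)   = ⊥-elim (All.lookup x∉ y∈xs refl)
  ... | inj₂ (there y∈bs)  = ∈-++⁺ʳ as y∈bs

module GraphNotions {n : ℕ} (G : Graph n) where

  E : List (Edge n)
  E = edges G

  no-loop : ∀ {e} → e ∈ₗ E → proj₁ e ≢ proj₂ e
  no-loop e∈E p≡q = <-irrefl (cong toℕ p≡q) (All.lookup (ordered G) e∈E)

  Touches : Subset n → Edge n → Set
  Touches C e = proj₁ e ∈ C ⊎ proj₂ e ∈ C

  Touches? : ∀ C → Decidable (Touches C)
  Touches? C e = (proj₁ e ∈? C) ⊎-dec (proj₂ e ∈? C)

  Touches-⊆ : ∀ {C D} → (∀ {v} → v ∈ C → v ∈ D) → ∀ {e} → Touches C e → Touches D e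
  Touches-⊆ C⊆D (inj₁ p∈C) = inj₁ (C⊆D p∈C)
  Touches-⊆ C⊆D (inj₂ q∈C) = inj₂ (C⊆D q∈C)

  ∈ₑ∧∈⇒Touches : ∀ {C v e} → v ∈ₑ e → v ∈ C → Touches C e
  ∈ₑ∧∈⇒Touches (inj₁ refl) v∈C = inj₁ v∈C
  ∈ₑ∧∈⇒Touches (inj₂ refl) v∈C = inj₂ v∈C

  Closed : Subset n → Set
  Closed C = ∀ {e} → e ∈ₗ E → Touches C e → proj₁ e ∈ C × proj₂ e ∈ C

  EV₀-empty : ∀ C → Empty C → EV₀ G C ≡ []
  EV₀-empty C empty = filter-none (Touches? C) {xs = E} (tabulate λ _ → λ { (inj₁ p∈C) → empty (_ , p∈C) ; (inj₂ q∈C) → empty (_ , q∈C) })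

module Construction (m : ℕ) {n : ℕ} (G : Graph n) where

  open PairedSequence m public
  open GraphNotions G public

  sumAt : (Edge n → Fin k) → Fin n → ℕ
  sumAt f v = s E f v

  s-EV₀ : ∀ C f {v} → v ∈ C → s (EV₀ G C) f v ≡ sumAt f v
  s-EV₀ C f v∈C = s-filter (Touches? C) E f _ (λ v∈ₑe → ∈ₑ∧∈⇒Touches v∈ₑe v∈C)

  sumAt-[≔]-endpoint : ∀ f {e} c {v} → e ∈ₗ E → f e ≡ zero → v ∈ₑ e → sumAt (f [ e ≔ c ]) v ≡ sumAt f v + toℕ c
  sumAt-[≔]-endpoint f c {v} e∈E fe≡0 v∈ₑe = begin
    sumAt (f [ _ ≔ c ]) v                        ≡⟨ s-[≔] E f _ c v (unique G) e∈E fe≡0 ⟩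
    sumAt f v + indicator (v ∈ₑ? _) * toℕ c      ≡⟨ cong (λ i → sumAt f v + i * toℕ c) (indicator-yes (v ∈ₑ? _) v∈ₑe) ⟩
    sumAt f v + 1 * toℕ c                        ≡⟨ cong (sumAt f v +_) (*-identityˡ (toℕ c)) ⟩
    sumAt f v + toℕ c                            ∎
    where open ≡-Reasoning

  sumAt-[≔]-other : ∀ f {e} c {v} → e ∈ₗ E → f e ≡ zero → ¬ (v ∈ₑ e) → sumAt (f [ e ≔ c ]) v ≡ sumAt f v
  sumAt-[≔]-other f c {v} e∈E fe≡0 v∉ₑe = begin
    sumAt (f [ _ ≔ c ]) v                        ≡⟨ s-[≔] E f _ c v (unique G) e∈E fe≡0 ⟩
    sumAt f v + indicator (v ∈ₑ? _) * toℕ c      ≡⟨ cong (λ i → sumAt f v + i * toℕ c) (indicator-no (v ∈ₑ? _) v∉ₑe) ⟩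
    sumAt f v + 0                                ≡⟨ +-identityʳ (sumAt f v) ⟩
    sumAt f v                                    ∎
    where open ≡-Reasoning

  -- A solution on C that has used a prefix of the paired sequence: besides that prefix, every
  -- vertex of C but one may cost one extra edge of each colour, and colour 0 one more.
  record Partial (C : Subset n) : Set where
    constructor partial
    field
      colouring    : Edge n → Fin k
      position     : Cursor
      balanced     : ∀ {v} → v ∈ C → k ∣ sumAt colouring v
      blank-off    : ∀ {e} → ¬ Touches C e → colouring e ≡ zero
      consumed≤    : consumed position ≤ length (EV₀ G C)
      colourCount≤ : ∀ c → colourCount (EV₀ G C) colouring c ≤ occurrences c position + (∣ C ∣ ∸ 1) + indicator (c ≟ zero)
  open Partial public

  partial-bound : ∀ {C} (r : Partial C) c → 1 ≤ ∣ C ∣ →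
                  k * colourCount (EV₀ G C) (colouring r) c ≤ length (EV₀ G C) + k * ∣ C ∣
  partial-bound {C} r c 1≤∣C∣ = begin
    k * colourCount (EV₀ G C) (colouring r) c            ≤⟨ *-monoʳ-≤ k (colourCount≤ r c) ⟩
    k * (o + (∣ C ∣ ∸ 1) + i)                            ≡⟨ ℕ-solve 4 (λ k o d i → k :* (o :+ d :+ i) := k :* o :+ k :* i :+ k :* d) refl k o (∣ C ∣ ∸ 1) i ⟩
    k * o + k * i + k * (∣ C ∣ ∸ 1)                      ≤⟨ +-monoˡ-≤ (k * (∣ C ∣ ∸ 1)) (occurrences-budget c (position r)) ⟩
    consumed (position r) + k + k * (∣ C ∣ ∸ 1)          ≡⟨ +-assoc (consumed (position r)) k _ ⟩
    consumed (position r) + (k + k * (∣ C ∣ ∸ 1))        ≡⟨ cong (consumed (position r) +_) (sym (*-suc k (∣ C ∣ ∸ 1))) ⟩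
    consumed (position r) + k * suc (∣ C ∣ ∸ 1)          ≡⟨ cong (λ x → consumed (position r) + k * x) (m+[n∸m]≡n 1≤∣C∣) ⟩
    consumed (position r) + k * ∣ C ∣                    ≤⟨ +-monoˡ-≤ (k * ∣ C ∣) (consumed≤ r) ⟩
    length (EV₀ G C) + k * ∣ C ∣                         ∎
    where
    open ≤-Reasoning
    o = occurrences c (position r)
    i = indicator (c ≟ zero)

  partial-blank : ∀ C → length (EV₀ G C) ≤ ∣ C ∣ → Partial C
  partial-blank C few = partial blank origin (λ {v} _ → subst (k ∣_) (sym (s-blank {k = double m} E v)) (divides 0 refl)) (λ _ → refl) z≤n count≤
    where
    count≤ : ∀ c → colourCount (EV₀ G C) blank c ≤ occurrences c origin + (∣ C ∣ ∸ 1) + indicator (c ≟ zero)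
    count≤ c with c ≟ zero
    ... | yes refl = begin
      colourCount (EV₀ G C) blank zero      ≤⟨ colourCount≤length (EV₀ G C) blank zero ⟩
      length (EV₀ G C)                      ≤⟨ few ⟩
      ∣ C ∣                                 ≤⟨ m≤n+m∸n ∣ C ∣ 1 ⟩
      1 + (∣ C ∣ ∸ 1)                       ≡⟨ +-comm 1 (∣ C ∣ ∸ 1) ⟩
      ∣ C ∣ ∸ 1 + 1                         ≡⟨ cong (λ o → o + (∣ C ∣ ∸ 1) + 1) (sym (occurrences-origin zero)) ⟩
      occurrences zero origin + (∣ C ∣ ∸ 1) + 1 ∎
      where open ≤-Reasoning
    ... | no c≢0 = subst (_≤ _) (sym (colourCount-blank (EV₀ G C) c≢0)) z≤n

  record StarColouring : Set where
    constructor coloured⋆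
    field
      starColouring : Edge n → Fin k
      starCursor    : Cursor
      starSum       : ℕ
  open StarColouring public

  -- R is the sum reached so far at the centre of the star.
  colourStar : List (Edge n) → (Edge n → Fin k) → Cursor → ℕ → StarColouring
  colourStar []           f s R = coloured⋆ f s R
  colourStar (b ∷ [])     f s R = coloured⋆ (f [ b ≔ complement R ]) s R
  colourStar (b ∷ b′ ∷ B) f s R = colourStar (b′ ∷ B) (f [ b ≔ current s ]) (advance s) (R + toℕ (current s))

  Fresh : (Edge n → Fin k) → List (Edge n) → Set
  Fresh f B = Unique B × (∀ {e} → e ∈ₗ B → e ∈ₗ E × f e ≡ zero)

  Fresh-∷⁻ : ∀ {f b B} c → Fresh f (b ∷ B) → Fresh (f [ b ≔ c ]) B
  Fresh-∷⁻ {f} {b} c (uB@(_ ∷ uB′) , fresh) =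
    uB′ , λ e∈B → proj₁ (fresh (there e∈B)) , trans ([≔]-∉ f b c (∉-∷⁻ uB) e∈B) (proj₂ (fresh (there e∈B)))

  star-outside : ∀ B f s R {x} → x ∉ₗ B → starColouring (colourStar B f s R) x ≡ f x
  star-outside []           f s R x∉B = refl
  star-outside (b ∷ [])     f s R x∉B = [≔]-other f b _ (x∉B ∘ here)
  star-outside (b ∷ b′ ∷ B) f s R x∉B =
    trans (star-outside (b′ ∷ B) _ (advance s) _ (x∉B ∘ there)) ([≔]-other f b (current s) (x∉B ∘ here))

  star-centre : ∀ b B f s R {u} → Fresh f (b ∷ B) → (∀ {e} → e ∈ₗ b ∷ B → u ∈ₑ e) → R ≡ sumAt f u →
                k ∣ sumAt (starColouring (colourStar (b ∷ B) f s R)) u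
  star-centre b [] f s R (_ , fresh) centre R≡ =
    subst (k ∣_) (sym (trans (sumAt-[≔]-endpoint f _ b∈E fb≡0 (centre (here refl))) (cong (_+ _) (sym R≡)))) (complement-∣ R)
    where
    b∈E = proj₁ (fresh (here refl))
    fb≡0 = proj₂ (fresh (here refl))
  star-centre b (b′ ∷ B) f s R fresh centre R≡ =
    star-centre b′ B _ (advance s) _ (Fresh-∷⁻ (current s) fresh) (centre ∘ there)
      (sym (trans (sumAt-[≔]-endpoint f _ (proj₁ (proj₂ fresh (here refl))) (proj₂ (proj₂ fresh (here refl))) (centre (here refl)))
                  (cong (_+ _) (sym R≡))))

  star-away : ∀ B f s R {v} → Fresh f B → (∀ {e} → e ∈ₗ B → ¬ (v ∈ₑ e)) →
              sumAt (starColouring (colourStar B f s R)) v ≡ sumAt f v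
  star-away []           f s R fresh away = refl
  star-away (b ∷ [])     f s R fresh away =
    sumAt-[≔]-other f _ (proj₁ (proj₂ fresh (here refl))) (proj₂ (proj₂ fresh (here refl))) (away (here refl))
  star-away (b ∷ b′ ∷ B) f s R fresh away =
    trans (star-away (b′ ∷ B) _ (advance s) _ (Fresh-∷⁻ (current s) fresh) (away ∘ there))
          (sumAt-[≔]-other f _ (proj₁ (proj₂ fresh (here refl))) (proj₂ (proj₂ fresh (here refl))) (away (here refl)))

  star-colourCount : ∀ b B f s R c → Unique (b ∷ B) →
    let r = colourStar (b ∷ B) f s R in
    colourCount (b ∷ B) (starColouring r) c + occurrences c s ≡ occurrences c (starCursor r) + indicator (complement (starSum r) ≟ c)
  star-colourCount b [] f s R c _ = begin
    colourCount (b ∷ []) (f [ b ≔ complement R ]) c + occurrences c s   ≡⟨ cong (_+ occurrences c s) (colourCount-∷ b [] (f [ b ≔ complement R ]) c) ⟩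
    indicator ((f [ b ≔ complement R ]) b ≟ c) + 0 + occurrences c s    ≡⟨ cong (λ x → indicator (x ≟ c) + 0 + occurrences c s) ([≔]-same f b _) ⟩
    indicator (complement R ≟ c) + 0 + occurrences c s                  ≡⟨ trans (cong (_+ occurrences c s) (+-identityʳ (indicator (complement R ≟ c)))) (+-comm _ (occurrences c s)) ⟩
    occurrences c s + indicator (complement R ≟ c)                      ∎
    where open ≡-Reasoning
  star-colourCount b (b′ ∷ B) f s R c uB@(_ ∷ uB′) = begin
    colourCount (b ∷ b′ ∷ B) f′ c + occurrences c s                   ≡⟨ cong (_+ occurrences c s) (colourCount-∷ b (b′ ∷ B) f′ c) ⟩
    indicator (f′ b ≟ c) + rest + occurrences c s                     ≡⟨ cong (λ x → indicator (x ≟ c) + rest + occurrences c s) f′b≡ ⟩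
    indicator (current s ≟ c) + rest + occurrences c s                ≡⟨ +-comm-middle (indicator (current s ≟ c)) rest (occurrences c s) ⟩
    rest + (occurrences c s + indicator (current s ≟ c))              ≡⟨ cong (rest +_) (sym (occurrences-advance c s)) ⟩
    rest + occurrences c (advance s)                                  ≡⟨ star-colourCount b′ B _ (advance s) _ c uB′ ⟩
    occurrences c (starCursor r) + indicator (complement (starSum r) ≟ c) ∎
    where
    open ≡-Reasoning
    r = colourStar (b′ ∷ B) (f [ b ≔ current s ]) (advance s) (R + toℕ (current s))
    f′ = starColouring r
    rest = colourCount (b′ ∷ B) f′ c
    f′b≡ : f′ b ≡ current s
    f′b≡ = trans (star-outside (b′ ∷ B) _ (advance s) _ (∉-∷⁻ uB)) ([≔]-same f b (current s))
    +-comm-middle : ∀ a b c → a + b + c ≡ b + (c + a)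
    +-comm-middle a b c = trans (cong (_+ c) (+-comm a b)) (trans (+-assoc b a c) (cong (b +_) (+-comm a c)))

  star-consumed : ∀ b B f s R → suc (consumed (starCursor (colourStar (b ∷ B) f s R))) ≡ consumed s + length (b ∷ B)
  star-consumed b []       f s R = +-comm 1 (consumed s)
  star-consumed b (b′ ∷ B) f s R = begin
    suc (consumed (starCursor (colourStar (b′ ∷ B) _ (advance s) _)))  ≡⟨ star-consumed b′ B _ (advance s) _ ⟩
    consumed (advance s) + length (b′ ∷ B)                                 ≡⟨ cong (_+ length (b′ ∷ B)) (consumed-advance s) ⟩
    suc (consumed s) + length (b′ ∷ B)                                     ≡⟨ sym (+-suc (consumed s) (length (b′ ∷ B))) ⟩
    consumed s + length (b ∷ b′ ∷ B)                                       ∎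
    where open ≡-Reasoning

  star-settled : ∀ B f s R → Settled s R → Settled (starCursor (colourStar B f s R)) (starSum (colourStar B f s R))
  star-settled []           f s R settled = settled
  star-settled (b ∷ [])     f s R settled = settled
  star-settled (b ∷ b′ ∷ B) f s R settled = star-settled (b′ ∷ B) _ (advance s) _ (settled-advance s R settled)

  module Star (C : Subset n) (u : Fin n) where

    open FilterSplit (Touches? C) (Touches? (C - u)) (Touches-⊆ (p─q⊆p C _)) public

    edges⋆ : List (Edge n)
    edges⋆ = filter P∖Q? E

    unique⋆ : Unique edges⋆
    unique⋆ = Unique.filter⁺ P∖Q? (unique G)

    ⋆⊆E : ∀ {e} → e ∈ₗ edges⋆ → e ∈ₗ E
    ⋆⊆E e∈⋆ = proj₁ (∈-filter⁻ P∖Q? {xs = E} e∈⋆)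

    ⋆-touches : ∀ {e} → e ∈ₗ edges⋆ → Touches C e × ¬ Touches (C - u) e
    ⋆-touches e∈⋆ = proj₂ (∈-filter⁻ P∖Q? {xs = E} e∈⋆)

    ⋆-centre : ∀ {e} → e ∈ₗ edges⋆ → u ∈ₑ e
    ⋆-centre {p , q} e∈⋆ with ⋆-touches e∈⋆ | p ≟ u | q ≟ u
    ... | _                  | yes p≡u | _       = inj₁ (sym p≡u)
    ... | _                  | no _    | yes q≡u = inj₂ (sym q≡u)
    ... | inj₁ p∈C , ¬touch | no p≢u  | no _     = ⊥-elim (¬touch (inj₁ (x∈p∧x≢y⇒x∈p-y p∈C p≢u)))
    ... | inj₂ q∈C , ¬touch | no _    | no q≢u   = ⊥-elim (¬touch (inj₂ (x∈p∧x≢y⇒x∈p-y q∈C q≢u)))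

    length-EV₀ : length (EV₀ G C) ≡ length (EV₀ G (C - u)) + length edges⋆
    length-EV₀ = length-filter-split E

    colourCount-EV₀ : ∀ (f : Edge n → Fin k) c → colourCount (EV₀ G C) f c ≡ colourCount (EV₀ G (C - u)) f c + colourCount edges⋆ f c
    colourCount-EV₀ f c = length-filter-filter-split {R = λ e → f e ≡ c} (λ e → f e ≟ c) E

  partial-extend-star : ∀ {C u e₀} → u ∈ C → e₀ ∈ₗ Star.edges⋆ C u → 1 ≤ ∣ C - u ∣ → Partial (C - u) → Partial C
  partial-extend-star {C} {u} u∈C e₀∈⋆ 1≤∣C′∣ r with Star.edges⋆ C u in ⋆≡ | e₀∈⋆
  ... | b ∷ B | _ = partial f′ s′ balanced′ blank′ consumed′ count′
    where
    open Star C u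
    C′ = C - u
    f₀ = colouring r
    s₀ = position r
    result = colourStar (b ∷ B) f₀ s₀ (sumAt f₀ u)
    f′ = starColouring result
    s′ = starCursor result

    ∈star⇒∈⋆ : ∀ {e} → e ∈ₗ b ∷ B → e ∈ₗ edges⋆
    ∈star⇒∈⋆ e∈ = subst (_ ∈ₗ_) (sym ⋆≡) e∈

    fresh : Fresh f₀ (b ∷ B)
    fresh = subst Unique ⋆≡ unique⋆ , λ e∈ → ⋆⊆E (∈star⇒∈⋆ e∈) , blank-off r (proj₂ (⋆-touches (∈star⇒∈⋆ e∈)))

    balanced′ : ∀ {v} → v ∈ C → k ∣ sumAt f′ v
    balanced′ {v} v∈C with v ≟ u
    ... | yes refl = star-centre b B f₀ s₀ _ fresh (⋆-centre ∘ ∈star⇒∈⋆) refl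
    ... | no v≢u   = subst (k ∣_) (sym (star-away (b ∷ B) f₀ s₀ _ fresh away)) (balanced r v∈C′)
      where
      v∈C′ : v ∈ C′
      v∈C′ = x∈p∧x≢y⇒x∈p-y v∈C v≢u
      away : ∀ {e} → e ∈ₗ b ∷ B → ¬ (v ∈ₑ e)
      away e∈ v∈ₑe = proj₂ (⋆-touches (∈star⇒∈⋆ e∈)) (∈ₑ∧∈⇒Touches v∈ₑe v∈C′)

    blank′ : ∀ {e} → ¬ Touches C e → f′ e ≡ zero
    blank′ ¬touch = trans (star-outside (b ∷ B) f₀ s₀ _ (¬touch ∘ proj₁ ∘ ⋆-touches ∘ ∈star⇒∈⋆))
                          (blank-off r (¬touch ∘ Touches-⊆ (p─q⊆p C _)))

    consumed′ : consumed s′ ≤ length (EV₀ G C)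
    consumed′ = begin
      consumed s′                                         ≤⟨ n≤1+n _ ⟩
      suc (consumed s′)                                   ≡⟨ star-consumed b B f₀ s₀ _ ⟩
      consumed s₀ + length (b ∷ B)                        ≤⟨ +-monoˡ-≤ _ (consumed≤ r) ⟩
      length (EV₀ G C′) + length (b ∷ B)                  ≡⟨ cong (λ B′ → length (EV₀ G C′) + length B′) (sym ⋆≡) ⟩
      length (EV₀ G C′) + length edges⋆                   ≡⟨ sym length-EV₀ ⟩
      length (EV₀ G C)                                    ∎
      where open ≤-Reasoning

    count′ : ∀ c → colourCount (EV₀ G C) f′ c ≤ occurrences c s′ + (∣ C ∣ ∸ 1) + indicator (c ≟ zero)
    count′ c = begin
      colourCount (EV₀ G C) f′ c                                  ≡⟨ colourCount-EV₀ f′ c ⟩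
      colourCount (EV₀ G C′) f′ c + colourCount edges⋆ f′ c      ≡⟨ cong₂ _+_ (colourCount-cong (EV₀ G C′) f′ f₀ c unchanged) (cong (λ B′ → colourCount B′ f′ c) ⋆≡) ⟩
      colourCount (EV₀ G C′) f₀ c + X                             ≤⟨ +-monoˡ-≤ X (colourCount≤ r c) ⟩
      occurrences c s₀ + d′ + i + X                               ≡⟨ ℕ-solve 4 (λ o d′ i x → o :+ d′ :+ i :+ x := (x :+ o) :+ (d′ :+ i)) refl (occurrences c s₀) d′ i X ⟩
      X + occurrences c s₀ + (d′ + i)                             ≡⟨ cong (_+ (d′ + i)) (star-colourCount b B f₀ s₀ _ c (subst Unique ⋆≡ unique⋆)) ⟩
      occurrences c s′ + j + (d′ + i)                             ≤⟨ +-monoˡ-≤ (d′ + i) (+-monoʳ-≤ (occurrences c s′) (indicator≤1 (complement (starSum result) ≟ c))) ⟩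
      occurrences c s′ + 1 + (d′ + i)                             ≡⟨ ℕ-solve 4 (λ o d′ i x → o :+ con 1 :+ (d′ :+ i) := o :+ (con 1 :+ d′) :+ i) refl (occurrences c s′) d′ i X ⟩
      occurrences c s′ + (1 + d′) + i                             ≤⟨ +-monoˡ-≤ i (+-monoʳ-≤ (occurrences c s′) 1+d′≤d) ⟩
      occurrences c s′ + (∣ C ∣ ∸ 1) + i                          ∎
      where
      open ≤-Reasoning
      X = colourCount (b ∷ B) f′ c
      d′ = ∣ C′ ∣ ∸ 1
      i = indicator (c ≟ zero)
      j = indicator (complement (starSum result) ≟ c)
      unchanged : ∀ {e} → e ∈ₗ EV₀ G C′ → f′ e ≡ f₀ e
      unchanged e∈ = star-outside (b ∷ B) f₀ s₀ _ (λ e∈B → proj₂ (⋆-touches (∈star⇒∈⋆ e∈B)) (proj₂ (∈-filter⁻ (Touches? C′) {xs = E} e∈)))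
      1+d′≤d : 1 + d′ ≤ ∣ C ∣ ∸ 1
      1+d′≤d = subst (_≤ ∣ C ∣ ∸ 1) (sym (m+[n∸m]≡n 1≤∣C′∣)) (∸-monoˡ-≤ 1 (x∈p⇒∣p-x∣<∣p∣ u∈C))

  indicator-≟-sym : ∀ {l} (a b : Fin l) → indicator (a ≟ b) ≡ indicator (b ≟ a)
  indicator-≟-sym a b with a ≟ b | b ≟ a
  ... | yes _   | yes _   = refl
  ... | yes a≡b | no b≢a  = ⊥-elim (b≢a (sym a≡b))
  ... | no a≢b  | yes b≡a = ⊥-elim (a≢b (sym b≡a))
  ... | no _    | no _    = refl

  -- With no vertex left to absorb an extra edge, the last colour is absorbed either by
  -- colour 0 or by the paired sequence itself: the sequence is restarted for this star.
  partial-last-star : ∀ {C u e₀} → u ∈ C → e₀ ∈ₗ Star.edges⋆ C u → Empty (C - u) → Partial C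
  partial-last-star {C} {u} u∈C e₀∈⋆ empty with Star.edges⋆ C u in ⋆≡ | e₀∈⋆
  ... | b ∷ B | _ = finish (complement-settled s′ (starSum result) (star-settled (b ∷ B) blank origin 0 settled-origin))
    where
    open Star C u
    result = colourStar (b ∷ B) blank origin 0
    f′ = starColouring result
    s′ = starCursor result
    closing = complement (starSum result)

    ∈star⇒∈⋆ : ∀ {e} → e ∈ₗ b ∷ B → e ∈ₗ edges⋆
    ∈star⇒∈⋆ e∈ = subst (_ ∈ₗ_) (sym ⋆≡) e∈

    balanced′ : ∀ {v} → v ∈ C → k ∣ sumAt f′ v
    balanced′ {v} v∈C with v ≟ u
    ... | yes refl = star-centre b B blank origin 0 {u} (subst Unique ⋆≡ unique⋆ , λ e∈ → ⋆⊆E (∈star⇒∈⋆ e∈) , refl)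
                                   (λ e∈ → ⋆-centre (∈star⇒∈⋆ e∈)) (sym (s-blank {k = double m} E u))
    ... | no v≢u   = ⊥-elim (empty (v , x∈p∧x≢y⇒x∈p-y v∈C v≢u))

    blank′ : ∀ {e} → ¬ Touches C e → f′ e ≡ zero
    blank′ ¬touch = star-outside (b ∷ B) blank origin 0 (¬touch ∘ proj₁ ∘ ⋆-touches ∘ ∈star⇒∈⋆)

    length-EV₀≡ : length (EV₀ G C) ≡ suc (consumed s′)
    length-EV₀≡ = begin
      length (EV₀ G C)                          ≡⟨ length-EV₀ ⟩
      length (EV₀ G (C - u)) + length edges⋆    ≡⟨ cong₂ (λ A B′ → length A + length B′) (EV₀-empty (C - u) empty) ⋆≡ ⟩
      length (b ∷ B)                            ≡⟨ sym (star-consumed b B blank origin 0) ⟩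
      suc (consumed s′)                         ∎
      where open ≡-Reasoning

    count≡ : ∀ c → colourCount (EV₀ G C) f′ c ≡ occurrences c s′ + indicator (closing ≟ c)
    count≡ c = begin
      colourCount (EV₀ G C) f′ c                                 ≡⟨ colourCount-EV₀ f′ c ⟩
      colourCount (EV₀ G (C - u)) f′ c + colourCount edges⋆ f′ c ≡⟨ cong₂ (λ A B′ → colourCount A f′ c + colourCount B′ f′ c) (EV₀-empty (C - u) empty) ⋆≡ ⟩
      colourCount (b ∷ B) f′ c                                   ≡⟨ sym (trans (cong (colourCount (b ∷ B) f′ c +_) (occurrences-origin c)) (+-identityʳ _)) ⟩
      colourCount (b ∷ B) f′ c + occurrences c origin            ≡⟨ star-colourCount b B blank origin 0 c (subst Unique ⋆≡ unique⋆) ⟩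
      occurrences c s′ + indicator (closing ≟ c) ∎
      where open ≡-Reasoning

    finish : toℕ (closing) ≡ 0 ⊎ closing ≡ current s′ → Partial C
    finish (inj₁ last≡0) = partial f′ s′ balanced′ blank′ (≤-trans (n≤1+n _) (≤-reflexive (sym length-EV₀≡))) count′
      where
      count′ : ∀ c → colourCount (EV₀ G C) f′ c ≤ occurrences c s′ + (∣ C ∣ ∸ 1) + indicator (c ≟ zero)
      count′ c = begin
        colourCount (EV₀ G C) f′ c                       ≡⟨ count≡ c ⟩
        occurrences c s′ + indicator (closing ≟ c)  ≡⟨ cong (λ x → occurrences c s′ + indicator (x ≟ c)) (toℕ-injective last≡0) ⟩
        occurrences c s′ + indicator (zero ≟ c)          ≡⟨ cong (occurrences c s′ +_) (indicator-≟-sym zero c) ⟩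
        occurrences c s′ + indicator (c ≟ zero)          ≤⟨ +-monoˡ-≤ _ (m≤m+n (occurrences c s′) (∣ C ∣ ∸ 1)) ⟩
        occurrences c s′ + (∣ C ∣ ∸ 1) + indicator (c ≟ zero) ∎
        where open ≤-Reasoning
    finish (inj₂ last≡current) = partial f′ (advance s′) balanced′ blank′ consumed′ count′
      where
      consumed′ : consumed (advance s′) ≤ length (EV₀ G C)
      consumed′ = ≤-reflexive (trans (consumed-advance s′) (sym length-EV₀≡))
      count′ : ∀ c → colourCount (EV₀ G C) f′ c ≤ occurrences c (advance s′) + (∣ C ∣ ∸ 1) + indicator (c ≟ zero)
      count′ c = begin
        colourCount (EV₀ G C) f′ c                       ≡⟨ count≡ c ⟩
        occurrences c s′ + indicator (closing ≟ c)  ≡⟨ cong (λ x → occurrences c s′ + indicator (x ≟ c)) last≡current ⟩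
        occurrences c s′ + indicator (current s′ ≟ c)    ≡⟨ sym (occurrences-advance c s′) ⟩
        occurrences c (advance s′)                       ≤⟨ m≤m+n _ _ ⟩
        occurrences c (advance s′) + (∣ C ∣ ∸ 1)         ≤⟨ m≤m+n _ _ ⟩
        occurrences c (advance s′) + (∣ C ∣ ∸ 1) + indicator (c ≟ zero) ∎
        where open ≤-Reasoning

∑-∣ : ∀ {d l} (g : Fin l → ℕ) → (∀ v → d ∣ g v) → d ∣ ∑ g
∑-∣ {l = zero}  g d∣g = divides 0 refl
∑-∣ {l = suc l} g d∣g = ∣m∣n⇒∣m+n (d∣g zero) (∑-∣ (g ∘ suc) (d∣g ∘ suc))

∑-∣-except : ∀ {d l} (g : Fin l → ℕ) u → (∀ v → v ≢ u → d ∣ g v) → d ∣ ∑ g → d ∣ g u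
∑-∣-except {d} {suc l} g u d∣g d∣∑ =
  ∣m+n∣m⇒∣n (subst (d ∣_) (trans (sum-remove {i = u} g) (+-comm (g u) _)) d∣∑)
            (∑-∣ (removeAt g u) (λ v → d∣g _ (punchInᵢ≢i u v)))

∑-zero : ∀ {l} (g : Fin l → ℕ) → (∀ v → g v ≡ 0) → ∑ g ≡ 0
∑-zero {l} g g≗0 = trans (sum-cong-≗ {x = g} {y = λ _ → 0} g≗0) (sum-replicate-zero l)

indicator-suc≟suc : ∀ {l} (v w : Fin l) → indicator (suc v ≟ suc w) ≡ indicator (v ≟ w)
indicator-suc≟suc v w with v ≟ w
... | yes refl = refl
... | no _     = refl

∑-delta : ∀ {l} (a : Fin l → ℕ) w → ∑[ v < l ] (a v * indicator (v ≟ w)) ≡ a w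
∑-delta a zero = begin
  a zero * 1 + ∑[ v < _ ] (a (suc v) * indicator (suc v ≟ zero))  ≡⟨ cong₂ _+_ (*-identityʳ (a zero)) (∑-zero _ (λ v → trans (cong (a (suc v) *_) (indicator-no (suc v ≟ zero) λ ())) (*-zeroʳ (a (suc v))))) ⟩
  a zero + 0                                                        ≡⟨ +-identityʳ (a zero) ⟩
  a zero                                                            ∎
  where open ≡-Reasoning
∑-delta a (suc w) = begin
  a zero * indicator (zero ≟ suc w) + ∑[ v < _ ] (a (suc v) * indicator (suc v ≟ suc w)) ≡⟨ cong₂ _+_ (cong (a zero *_) (indicator-no (zero ≟ suc w) λ ())) (sum-cong-≗ (λ v → cong (a (suc v) *_) (indicator-suc≟suc v w))) ⟩
  a zero * 0 + ∑[ v < _ ] (a (suc v) * indicator (v ≟ w))                                 ≡⟨ cong₂ _+_ (*-zeroʳ (a zero)) (∑-delta (a ∘ suc) w) ⟩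
  a (suc w)                                                                               ∎
  where open ≡-Reasoning

sumₗ-cong : ∀ {a} {A : Set a} (xs : List A) (g h : A → ℕ) → (∀ {x} → x ∈ₗ xs → g x ≡ h x) → sumₗ (map g xs) ≡ sumₗ (map h xs)
sumₗ-cong []       g h g≗h = refl
sumₗ-cong (x ∷ xs) g h g≗h = cong₂ _+_ (g≗h (here refl)) (sumₗ-cong xs g h (g≗h ∘ there))

∑-sumₗ-comm : ∀ {a l} {A : Set a} (w : Fin l → ℕ) xs (h : Fin l → A → ℕ) →
              ∑[ v < l ] (w v * sumₗ (map (h v) xs)) ≡ sumₗ (map (λ x → ∑[ v < l ] (w v * h v x)) xs)
∑-sumₗ-comm w []       h = ∑-zero _ (λ v → *-zeroʳ (w v))
∑-sumₗ-comm w (x ∷ xs) h = begin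
  ∑[ v < _ ] (w v * (h v x + sumₗ (map (h v) xs)))                  ≡⟨ sum-cong-≗ (λ v → *-distribˡ-+ (w v) (h v x) _) ⟩
  ∑[ v < _ ] (w v * h v x + w v * sumₗ (map (h v) xs))              ≡⟨ ∑-distrib-+ (λ v → w v * h v x) _ ⟩
  ∑[ v < _ ] (w v * h v x) + ∑[ v < _ ] (w v * sumₗ (map (h v) xs)) ≡⟨ cong (∑[ v < _ ] (w v * h v x) +_) (∑-sumₗ-comm w xs h) ⟩
  sumₗ (map (λ y → ∑[ v < _ ] (w v * h v y)) (x ∷ xs))              ∎
  where open ≡-Reasoning

module Bipartite (m : ℕ) {n : ℕ} (G : Graph n) where

  open Construction m G

  s≡sumₗ : ∀ E′ (f : Edge n → Fin k) v → s E′ f v ≡ sumₗ (map (λ e → indicator (v ∈ₑ? e) * toℕ (f e)) E′)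
  s≡sumₗ []       f v = refl
  s≡sumₗ (x ∷ E′) f v = trans (s-∷ x E′ f v) (cong (_ +_) (s≡sumₗ E′ f v))

  indicator-∈ₑ : ∀ (v : Fin n) {e : Edge n} → proj₁ e ≢ proj₂ e → indicator (v ∈ₑ? e) ≡ indicator (v ≟ proj₁ e) + indicator (v ≟ proj₂ e)
  indicator-∈ₑ v {p , q} p≢q with v ≟ p | v ≟ q
  ... | yes refl | yes refl = ⊥-elim (p≢q refl)
  ... | yes _    | no _     = refl
  ... | no _     | yes _    = refl
  ... | no _     | no _     = refl

  ∑-weighted-edge : ∀ (w : Fin n → ℕ) {e} t → proj₁ e ≢ proj₂ e →
                    ∑[ v < n ] (w v * (indicator (v ∈ₑ? e) * t)) ≡ (w (proj₁ e) + w (proj₂ e)) * t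
  ∑-weighted-edge w {p , q} t p≢q = begin
    ∑[ v < n ] (w v * (indicator (v ∈ₑ? (p , q)) * t))                           ≡⟨ sum-cong-≗ (λ v → trans (sym (*-assoc (w v) (indicator (v ∈ₑ? (p , q))) t)) (cong (λ i → w v * i * t) (indicator-∈ₑ v p≢q))) ⟩
    ∑[ v < n ] (w v * (indicator (v ≟ p) + indicator (v ≟ q)) * t)               ≡⟨ *-distribʳ-sum t (λ v → w v * (indicator (v ≟ p) + indicator (v ≟ q))) ⟨
    ∑[ v < n ] (w v * (indicator (v ≟ p) + indicator (v ≟ q))) * t               ≡⟨ cong (_* t) (sum-cong-≗ (λ v → *-distribˡ-+ (w v) (indicator (v ≟ p)) _)) ⟩
    ∑[ v < n ] (w v * indicator (v ≟ p) + w v * indicator (v ≟ q)) * t           ≡⟨ cong (_* t) (∑-distrib-+ (λ v → w v * indicator (v ≟ p)) _) ⟩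
    (∑[ v < n ] (w v * indicator (v ≟ p)) + ∑[ v < n ] (w v * indicator (v ≟ q))) * t ≡⟨ cong₂ (λ a b → (a + b) * t) (∑-delta w p) (∑-delta w q) ⟩
    (w p + w q) * t                                                              ∎
    where open ≡-Reasoning

  ∑-weighted-sumAt : ∀ (w : Fin n → ℕ) f →
                     ∑[ v < n ] (w v * sumAt f v) ≡ sumₗ (map (λ e → (w (proj₁ e) + w (proj₂ e)) * toℕ (f e)) E)
  ∑-weighted-sumAt w f = begin
    ∑[ v < n ] (w v * sumAt f v)                                                      ≡⟨ sum-cong-≗ (λ v → cong (w v *_) (s≡sumₗ E f v)) ⟩
    ∑[ v < n ] (w v * sumₗ (map (λ e → indicator (v ∈ₑ? e) * toℕ (f e)) E))            ≡⟨ ∑-sumₗ-comm w E (λ v e → indicator (v ∈ₑ? e) * toℕ (f e)) ⟩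
    sumₗ (map (λ e → ∑[ v < n ] (w v * (indicator (v ∈ₑ? e) * toℕ (f e)))) E)          ≡⟨ sumₗ-cong E _ _ (λ {e} e∈E → ∑-weighted-edge w (toℕ (f e)) (no-loop e∈E)) ⟩
    sumₗ (map (λ e → (w (proj₁ e) + w (proj₂ e)) * toℕ (f e)) E)                      ∎
    where open ≡-Reasoning

  module _ (C : Subset n) (χ : Fin n → Bool)
           (closed : Closed C)
           (proper : ∀ {e} → e ∈ₗ E → Touches C e → χ (proj₁ e) ≢ χ (proj₂ e)) where

    side : Bool → Fin n → ℕ
    side b v = indicator ((v ∈? C) ×-dec (χ v ≟ᵇ b))

    side-edge : ∀ {e} → e ∈ₗ E → side true (proj₁ e) + side true (proj₂ e) ≡ side false (proj₁ e) + side false (proj₂ e)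
    side-edge {p , q} e∈E with p ∈? C | q ∈? C
    ... | yes p∈C | yes q∈C = opposite (χ p) (χ q) (proper e∈E (inj₁ p∈C))
      where
      opposite : ∀ x y → x ≢ y → indicator (yes p∈C ×-dec (x ≟ᵇ true)) + indicator (yes q∈C ×-dec (y ≟ᵇ true))
                               ≡ indicator (yes p∈C ×-dec (x ≟ᵇ false)) + indicator (yes q∈C ×-dec (y ≟ᵇ false))
      opposite true  true  x≢y = ⊥-elim (x≢y refl)
      opposite true  false _   = refl
      opposite false true  _   = refl
      opposite false false x≢y = ⊥-elim (x≢y refl)
    ... | yes p∈C | no q∉C  = ⊥-elim (q∉C (proj₂ (closed e∈E (inj₁ p∈C))))
    ... | no p∉C  | yes q∈C = ⊥-elim (p∉C (proj₁ (closed e∈E (inj₂ q∈C))))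
    ... | no _    | no _    = refl

    sides-balance : ∀ f → ∑[ v < n ] (side true v * sumAt f v) ≡ ∑[ v < n ] (side false v * sumAt f v)
    sides-balance f = begin
      ∑[ v < n ] (side true v * sumAt f v)                                              ≡⟨ ∑-weighted-sumAt (side true) f ⟩
      sumₗ (map (λ e → (side true (proj₁ e) + side true (proj₂ e)) * toℕ (f e)) E)     ≡⟨ sumₗ-cong E _ _ (λ {e} e∈E → cong (_* toℕ (f e)) (side-edge e∈E)) ⟩
      sumₗ (map (λ e → (side false (proj₁ e) + side false (proj₂ e)) * toℕ (f e)) E)   ≡⟨ ∑-weighted-sumAt (side false) f ⟨
      ∑[ v < n ] (side false v * sumAt f v)                                             ∎
      where open ≡-Reasoning

    side-∣ : ∀ b f {u} → (∀ {v} → v ∈ C → v ≢ u → k ∣ sumAt f v) → ∀ v → v ≢ u → k ∣ side b v * sumAt f v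
    side-∣ b f balanced v v≢u with v ∈? C
    ... | yes v∈C = ∣n⇒∣m*n (indicator (yes v∈C ×-dec (χ v ≟ᵇ b))) (balanced v∈C v≢u)
    ... | no _    = divides 0 refl

    side-other : ∀ {b v} → χ v ≢ b → side b v ≡ 0
    side-other {b} {v} χv≢b = indicator-no ((v ∈? C) ×-dec (χ v ≟ᵇ b)) (χv≢b ∘ proj₂)

    side-own : ∀ {v} → v ∈ C → side (χ v) v ≡ 1
    side-own {v} v∈C = indicator-yes ((v ∈? C) ×-dec (χ v ≟ᵇ χ v)) (v∈C , refl)

    -- Every edge touching C has one endpoint on each side, so the two sides carry equal sums.
    bipartite-balanced : ∀ f {u} → u ∈ C → (∀ {v} → v ∈ C → v ≢ u → k ∣ sumAt f v) → k ∣ sumAt f u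
    bipartite-balanced f {u} u∈C balanced =
      subst (k ∣_) (trans (cong (_* sumAt f u) (side-own u∈C)) (*-identityˡ _))
            (∑-∣-except _ u (side-∣ (χ u) f balanced) (subst (k ∣_) (sym (same-sides (χ u))) (∑-∣ _ other-side-∣)))
      where
      same-sides : ∀ b → ∑[ v < n ] (side b v * sumAt f v) ≡ ∑[ v < n ] (side (not b) v * sumAt f v)
      same-sides true  = sides-balance f
      same-sides false = sym (sides-balance f)
      other-side-∣ : ∀ v → k ∣ side (not (χ u)) v * sumAt f v
      other-side-∣ v with v ≟ u
      ... | yes refl = subst (λ w → k ∣ w * sumAt f u) (sym (side-other {not (χ u)} {u} (not-¬ refl))) (divides 0 refl)
      ... | no v≢u = side-∣ (not (χ u)) f balanced v v≢u

xor-cancelʳ : ∀ u d → (u xor d) xor d ≡ u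
xor-cancelʳ u d = trans (xor-assoc u d d) (trans (cong (u xor_) (xor-same d)) (xor-identityʳ u))

xor-both : ∀ u v d → (u xor d) xor (v xor d) ≡ u xor v
xor-both u v d = begin
  (u xor d) xor (v xor d)  ≡⟨ xor-solve 3 (λ u v d → (u ⊕ d) ⊕ (v ⊕ d) ⊜ (u ⊕ v) ⊕ (d ⊕ d)) refl u v d ⟩
  (u xor v) xor (d xor d)  ≡⟨ cong ((u xor v) xor_) (xor-same d) ⟩
  (u xor v) xor false      ≡⟨ xor-identityʳ (u xor v) ⟩
  u xor v                  ∎
  where open ≡-Reasoning

module Walks {n : ℕ} (G : Graph n) where

  open GraphNotions G

  _∈ᵛ?_ : ∀ (v : Fin n) vs → Dec (v ∈ₗ vs)
  _∈ᵛ?_ = DecMembership._∈?_ _≟_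

  _∈ᵉ?_ : ∀ (e : Edge n) es → Dec (e ∈ₗ es)
  _∈ᵉ?_ = DecMembership._∈?_ _≟ₑ_

  Adjacent : Fin n → Fin n → Set
  Adjacent x y = (x , y) ∈ₗ E ⊎ (y , x) ∈ₗ E

  Adjacent-sym : ∀ {x y} → Adjacent x y → Adjacent y x
  Adjacent-sym (inj₁ xy∈E) = inj₂ xy∈E
  Adjacent-sym (inj₂ yx∈E) = inj₁ yx∈E

  infixr 5 _∷_ _++ʷ_
  data Walk : Fin n → Fin n → Set where
    []  : ∀ {x} → Walk x x
    _∷_ : ∀ {x y z} → Adjacent x y → Walk y z → Walk x z

  lengthʷ : ∀ {x y} → Walk x y → ℕ
  lengthʷ []      = 0
  lengthʷ (_ ∷ w) = suc (lengthʷ w)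

  oddʷ : ∀ {x y} → Walk x y → Bool
  oddʷ []      = false
  oddʷ (_ ∷ w) = not (oddʷ w)

  _++ʷ_ : ∀ {x y z} → Walk x y → Walk y z → Walk x z
  []      ++ʷ w = w
  (a ∷ v) ++ʷ w = a ∷ (v ++ʷ w)

  ++ʷ-assoc : ∀ {x y z t} (u : Walk x y) (v : Walk y z) (w : Walk z t) → (u ++ʷ v) ++ʷ w ≡ u ++ʷ (v ++ʷ w)
  ++ʷ-assoc []      v w = refl
  ++ʷ-assoc (a ∷ u) v w = cong (a ∷_) (++ʷ-assoc u v w)

  lengthʷ-++ : ∀ {x y z} (v : Walk x y) (w : Walk y z) → lengthʷ (v ++ʷ w) ≡ lengthʷ v + lengthʷ w
  lengthʷ-++ []      w = refl
  lengthʷ-++ (a ∷ v) w = cong suc (lengthʷ-++ v w)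

  oddʷ-++ : ∀ {x y z} (v : Walk x y) (w : Walk y z) → oddʷ (v ++ʷ w) ≡ oddʷ v xor oddʷ w
  oddʷ-++ []      w = refl
  oddʷ-++ (a ∷ v) w = trans (cong not (oddʷ-++ v w)) (not-distribˡ-xor (oddʷ v) (oddʷ w))

  verticesʷ : ∀ {x y} → Walk x y → List (Fin n)
  verticesʷ []          = []
  verticesʷ {x} (_ ∷ w) = x ∷ verticesʷ w

  edgeOf : ∀ {x y} → Adjacent x y → Edge n
  edgeOf {x} {y} (inj₁ _) = (x , y)
  edgeOf {x} {y} (inj₂ _) = (y , x)

  edgesʷ : ∀ {x y} → Walk x y → List (Edge n)
  edgesʷ []      = []
  edgesʷ (a ∷ w) = edgeOf a ∷ edgesʷ w

  verticesʷ-++ : ∀ {x y z} (v : Walk x y) (w : Walk y z) → verticesʷ (v ++ʷ w) ≡ verticesʷ v ++ verticesʷ w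
  verticesʷ-++ []      w = refl
  verticesʷ-++ (a ∷ v) w = cong (_ ∷_) (verticesʷ-++ v w)

  edgesʷ-++ : ∀ {x y z} (v : Walk x y) (w : Walk y z) → edgesʷ (v ++ʷ w) ≡ edgesʷ v ++ edgesʷ w
  edgesʷ-++ []      w = refl
  edgesʷ-++ (a ∷ v) w = cong (_ ∷_) (edgesʷ-++ v w)

  edgeOf∈E : ∀ {x z} (a : Adjacent x z) → edgeOf a ∈ₗ E
  edgeOf∈E (inj₁ xz∈E) = xz∈E
  edgeOf∈E (inj₂ zx∈E) = zx∈E

  source∈ₑedgeOf : ∀ {x z} (a : Adjacent x z) → x ∈ₑ edgeOf a
  source∈ₑedgeOf (inj₁ _) = inj₁ refl
  source∈ₑedgeOf (inj₂ _) = inj₂ refl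

  target∈ₑedgeOf : ∀ {x z} (a : Adjacent x z) → z ∈ₑ edgeOf a
  target∈ₑedgeOf (inj₁ _) = inj₂ refl
  target∈ₑedgeOf (inj₂ _) = inj₁ refl

  ∈ₑedgeOf : ∀ {x z} (a : Adjacent x z) {v} → v ∈ₑ edgeOf a → v ≡ x ⊎ v ≡ z
  ∈ₑedgeOf (inj₁ _) (inj₁ refl) = inj₁ refl
  ∈ₑedgeOf (inj₁ _) (inj₂ refl) = inj₂ refl
  ∈ₑedgeOf (inj₂ _) (inj₁ refl) = inj₂ refl
  ∈ₑedgeOf (inj₂ _) (inj₂ refl) = inj₁ refl

  start∈verticesʷ : ∀ {x y} (w : Walk x y) → x ∈ₗ verticesʷ w ⊎ x ≡ y
  start∈verticesʷ []      = inj₂ refl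
  start∈verticesʷ (_ ∷ _) = inj₁ (here refl)

  endpoint-on-walk : ∀ {x y} (w : Walk x y) {e} → e ∈ₗ edgesʷ w → ∀ {v} → v ∈ₑ e → v ∈ₗ verticesʷ w ⊎ v ≡ y
  endpoint-on-walk (a ∷ w) (here refl) v∈ₑe with ∈ₑedgeOf a v∈ₑe
  ... | inj₁ refl = inj₁ (here refl)
  ... | inj₂ refl with start∈verticesʷ w
  ...   | inj₁ v∈w = inj₁ (there v∈w)
  ...   | inj₂ v≡y = inj₂ v≡y
  endpoint-on-walk (a ∷ w) (there e∈w) v∈ₑe with endpoint-on-walk w e∈w v∈ₑe
  ... | inj₁ v∈w = inj₁ (there v∈w)
  ... | inj₂ v≡y = inj₂ v≡y

  length-verticesʷ : ∀ {x y} (w : Walk x y) → length (verticesʷ w) ≡ lengthʷ w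
  length-verticesʷ []      = refl
  length-verticesʷ (_ ∷ w) = cong suc (length-verticesʷ w)

  length-edgesʷ : ∀ {x y} (w : Walk x y) → length (edgesʷ w) ≡ lengthʷ w
  length-edgesʷ []      = refl
  length-edgesʷ (_ ∷ w) = cong suc (length-edgesʷ w)

  OddClosedWalk : Fin n → Set
  OddClosedWalk x = Σ (Walk x x) λ w → oddʷ w ≡ true

  module TwoColouring where

    record Partition (P : List (Edge n)) : Set where
      constructor partition
      field
        root   : Fin n → Fin n
        side   : Fin n → Bool
        proper : ∀ {e} → e ∈ₗ P → side (proj₁ e) ≢ side (proj₂ e)
        joined : ∀ {e} → e ∈ₗ P → root (proj₁ e) ≡ root (proj₂ e)
        linked : ∀ x y → root x ≡ root y → Σ (Walk x y) λ w → oddʷ w ≡ side x xor side y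

    discrete : Partition []
    discrete = partition (λ x → x) (λ _ → false) (λ ()) (λ ()) (λ { x .x refl → [] , refl })

    Conflict : List (Edge n) → Set
    Conflict P = Σ (Edge n) λ e → e ∈ₗ P × OddClosedWalk (proj₁ e)

    -- An edge inside a class must join opposite sides, else it closes an odd walk; an edge between
    -- two classes merges them, flipping the sides of the second class if necessary.
    insert : ∀ a b P → (a , b) ∈ₗ E → Partition P → OddClosedWalk a ⊎ Partition ((a , b) ∷ P)
    insert a b P ab∈E (partition root side proper joined linked) with root a ≟ root b
    ... | yes ra≡rb with side a ≟ᵇ side b
    ...   | yes sa≡sb = inj₁ (w ++ʷ (inj₂ ab∈E ∷ []) , odd-w)
      where
      w = proj₁ (linked a b ra≡rb)
      odd-w : oddʷ (w ++ʷ (inj₂ ab∈E ∷ [])) ≡ true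
      odd-w = begin
        oddʷ (w ++ʷ (inj₂ ab∈E ∷ []))  ≡⟨ oddʷ-++ w _ ⟩
        oddʷ w xor true                ≡⟨ cong (_xor true) (proj₂ (linked a b ra≡rb)) ⟩
        (side a xor side b) xor true   ≡⟨ cong (λ x → (side a xor x) xor true) (sym sa≡sb) ⟩
        (side a xor side a) xor true   ≡⟨ cong (_xor true) (xor-same (side a)) ⟩
        true                           ∎
        where open ≡-Reasoning
    ...   | no sa≢sb = inj₂ (partition root side proper′ joined′ linked)
      where
      proper′ : ∀ {e} → e ∈ₗ (a , b) ∷ P → side (proj₁ e) ≢ side (proj₂ e)
      proper′ (here refl) = sa≢sb
      proper′ (there e∈P) = proper e∈P
      joined′ : ∀ {e} → e ∈ₗ (a , b) ∷ P → root (proj₁ e) ≡ root (proj₂ e)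
      joined′ (here refl) = ra≡rb
      joined′ (there e∈P) = joined e∈P
    insert a b P ab∈E (partition root side proper joined linked) | no ra≢rb =
      inj₂ (partition root′ side′ proper′ joined′ linked′)
      where
      δ = side b xor not (side a)
      InB : Fin n → Set
      InB x = root x ≡ root b
      root′ : Fin n → Fin n
      root′ x with root x ≟ root b
      ... | yes _ = root a
      ... | no _  = root x
      side′ : Fin n → Bool
      side′ x with root x ≟ root b
      ... | yes _ = side x xor δ
      ... | no _  = side x
      root′-B : ∀ {x} → InB x → root′ x ≡ root a
      root′-B {x} x∈B with root x ≟ root b
      ... | yes _    = refl
      ... | no x∉B  = ⊥-elim (x∉B x∈B)
      root′-A : ∀ {x} → ¬ InB x → root′ x ≡ root x
      root′-A {x} x∉B with root x ≟ root b
      ... | yes x∈B = ⊥-elim (x∉B x∈B)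
      ... | no _    = refl
      side′-B : ∀ {x} → InB x → side′ x ≡ side x xor δ
      side′-B {x} x∈B with root x ≟ root b
      ... | yes _    = refl
      ... | no x∉B  = ⊥-elim (x∉B x∈B)
      side′-A : ∀ {x} → ¬ InB x → side′ x ≡ side x
      side′-A {x} x∉B with root x ≟ root b
      ... | yes x∈B = ⊥-elim (x∉B x∈B)
      ... | no _    = refl
      xor-δ-injective : ∀ {u v} → u xor δ ≡ v xor δ → u ≡ v
      xor-δ-injective {u} {v} eq = begin
        u                ≡⟨ xor-cancelʳ u δ ⟨
        (u xor δ) xor δ  ≡⟨ cong (_xor δ) eq ⟩
        (v xor δ) xor δ  ≡⟨ xor-cancelʳ v δ ⟩
        v                ∎
        where open ≡-Reasoning
      side′-b : side′ b ≡ not (side a)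
      side′-b = begin
        side′ b                              ≡⟨ side′-B refl ⟩
        side b xor (side b xor not (side a)) ≡⟨ xor-assoc (side b) (side b) _ ⟨
        (side b xor side b) xor not (side a) ≡⟨ cong (_xor not (side a)) (xor-same (side b)) ⟩
        not (side a)                         ∎
        where open ≡-Reasoning
      proper′ : ∀ {e} → e ∈ₗ (a , b) ∷ P → side′ (proj₁ e) ≢ side′ (proj₂ e)
      proper′ (here refl) eq = not-¬ refl (trans (sym (side′-A ra≢rb)) (trans eq side′-b))
      proper′ {c , d} (there cd∈P) eq with root c ≟ root b
      ... | yes c∈B = proper cd∈P (xor-δ-injective (trans eq (side′-B (trans (sym (joined cd∈P)) c∈B))))
      ... | no c∉B  = proper cd∈P (trans eq (side′-A (c∉B ∘ trans (joined cd∈P))))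
      joined′ : ∀ {e} → e ∈ₗ (a , b) ∷ P → root′ (proj₁ e) ≡ root′ (proj₂ e)
      joined′ (here refl) = trans (root′-A ra≢rb) (sym (root′-B refl))
      joined′ {c , d} (there cd∈P) with root c ≟ root b
      ... | yes c∈B = sym (root′-B (trans (sym (joined cd∈P)) c∈B))
      ... | no c∉B  = trans (joined cd∈P) (sym (root′-A (c∉B ∘ trans (joined cd∈P))))
      linked′ : ∀ x y → root′ x ≡ root′ y → Σ (Walk x y) λ w → oddʷ w ≡ side′ x xor side′ y
      linked′ x y eq with root x ≟ root b | root y ≟ root b
      ... | yes x∈B | yes y∈B = w , trans odd-w (sym (xor-both (side x) (side y) δ))
        where
        open Σ (linked x y (trans x∈B (sym y∈B))) renaming (proj₁ to w; proj₂ to odd-w)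
      ... | yes x∈B | no _ = w₁ ++ʷ (inj₂ ab∈E ∷ w₂) , (begin
        oddʷ (w₁ ++ʷ (inj₂ ab∈E ∷ w₂))                     ≡⟨ oddʷ-++ w₁ _ ⟩
        oddʷ w₁ xor not (oddʷ w₂)                         ≡⟨ cong₂ (λ p q → p xor not q) odd-w₁ odd-w₂ ⟩
        (side x xor side b) xor not (side a xor side y)    ≡⟨ xor-solve 5 (λ sx sb sa sy t → (sx ⊕ sb) ⊕ (t ⊕ (sa ⊕ sy)) ⊜ (sx ⊕ (sb ⊕ (t ⊕ sa))) ⊕ sy) refl (side x) (side b) (side a) (side y) true ⟩
        (side x xor δ) xor side y                          ∎)
        where
        open ≡-Reasoning
        open Σ (linked x b x∈B) renaming (proj₁ to w₁; proj₂ to odd-w₁)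
        open Σ (linked a y eq) renaming (proj₁ to w₂; proj₂ to odd-w₂)
      ... | no _ | yes y∈B = w₁ ++ʷ (inj₁ ab∈E ∷ w₂) , (begin
        oddʷ (w₁ ++ʷ (inj₁ ab∈E ∷ w₂))                     ≡⟨ oddʷ-++ w₁ _ ⟩
        oddʷ w₁ xor not (oddʷ w₂)                         ≡⟨ cong₂ (λ p q → p xor not q) odd-w₁ odd-w₂ ⟩
        (side x xor side a) xor not (side b xor side y)    ≡⟨ xor-solve 5 (λ sx sa sb sy t → (sx ⊕ sa) ⊕ (t ⊕ (sb ⊕ sy)) ⊜ sx ⊕ (sy ⊕ (sb ⊕ (t ⊕ sa)))) refl (side x) (side a) (side b) (side y) true ⟩
        side x xor (side y xor δ)                          ∎)
        where
        open ≡-Reasoning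
        open Σ (linked x a eq) renaming (proj₁ to w₁; proj₂ to odd-w₁)
        open Σ (linked b y (sym y∈B)) renaming (proj₁ to w₂; proj₂ to odd-w₂)
      ... | no _ | no _ = linked x y eq

    partition-or-conflict : ∀ P → (∀ {e} → e ∈ₗ P → e ∈ₗ E) → Conflict P ⊎ Partition P
    partition-or-conflict []             P⊆E = inj₂ discrete
    partition-or-conflict ((a , b) ∷ P) P⊆E with partition-or-conflict P (P⊆E ∘ there)
    ... | inj₁ (e , e∈P , walk) = inj₁ (e , there e∈P , walk)
    ... | inj₂ π with insert a b P (P⊆E (here refl)) π
    ...   | inj₁ walk = inj₁ ((a , b) , here refl , walk)
    ...   | inj₂ π′  = inj₂ π′

  open TwoColouring using (Partition; partition-or-conflict) public

  splitAt : ∀ {x y v} (W : Walk x y) → v ∈ₗ verticesʷ W →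
            Σ (Walk x v) λ P → Σ (Walk v y) λ Q → (P ++ʷ Q ≡ W) × (1 ≤ lengthʷ Q)
  splitAt (a ∷ w) (here refl) = [] , a ∷ w , refl , s≤s z≤n
  splitAt (a ∷ w) (there v∈w) with splitAt w v∈w
  ... | P , Q , P++Q≡w , 1≤Q = a ∷ P , Q , cong (a ∷_) P++Q≡w , 1≤Q

  record Split {x y} (W : Walk x y) (a b : Fin n) : Set where
    constructor split
    field
      front  : Walk x a
      middle : Walk a b
      back   : Walk b y
      splits : front ++ʷ (middle ++ʷ back) ≡ W

    length-split : lengthʷ W ≡ lengthʷ front + (lengthʷ middle + lengthʷ back)
    length-split = trans (cong lengthʷ (sym splits)) (trans (lengthʷ-++ front _) (cong (lengthʷ front +_) (lengthʷ-++ middle back)))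

    odd-split : oddʷ W ≡ oddʷ front xor (oddʷ middle xor oddʷ back)
    odd-split = trans (cong oddʷ (sym splits)) (trans (oddʷ-++ front _) (cong (oddʷ front xor_) (oddʷ-++ middle back)))

    edges-middle : ∀ {e} → e ∈ₗ edgesʷ middle → e ∈ₗ edgesʷ W
    edges-middle {e} e∈ = subst (λ w → e ∈ₗ edgesʷ w) splits
      (subst (e ∈ₗ_) (sym (trans (edgesʷ-++ front _) (cong (edgesʷ front ++_) (edgesʷ-++ middle back)))) (∈-++⁺ʳ (edgesʷ front) (∈-++⁺ˡ e∈)))

    edges-back : ∀ {e} → e ∈ₗ edgesʷ back → e ∈ₗ edgesʷ W
    edges-back {e} e∈ = subst (λ w → e ∈ₗ edgesʷ w) splits
      (subst (e ∈ₗ_) (sym (trans (edgesʷ-++ front _) (cong (edgesʷ front ++_) (edgesʷ-++ middle back)))) (∈-++⁺ʳ (edgesʷ front) (∈-++⁺ʳ (edgesʷ middle) e∈)))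

  Repetition : ∀ {x y} → Walk x y → Set
  Repetition W = ∃ λ v → Σ (Split W v v) λ s → 1 ≤ lengthʷ (Split.middle s) × 1 ≤ lengthʷ (Split.back s)

  unique-or-repetition : ∀ {x y} (W : Walk x y) → Unique (verticesʷ W) ⊎ Repetition W
  unique-or-repetition [] = inj₁ []
  unique-or-repetition {x} (a ∷ w) with x ∈ᵛ? verticesʷ w
  ... | yes x∈w with splitAt w x∈w
  ...   | P , Q , P++Q≡w , 1≤Q = inj₂ (x , split [] (a ∷ P) Q (cong (a ∷_) P++Q≡w) , s≤s z≤n , 1≤Q)
  unique-or-repetition {x} (a ∷ w) | no x∉w with unique-or-repetition w
  ... | inj₁ unique = inj₁ (All.tabulate (λ {y} y∈w x≡y → x∉w (subst (_∈ₗ verticesʷ w) (sym x≡y) y∈w)) ∷ unique)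
  ... | inj₂ (v , split P R Q splits , 1≤R , 1≤Q) = inj₂ (v , split (a ∷ P) R Q (cong (a ∷_) splits) , 1≤R , 1≤Q)

  Chord : ∀ {x} → Walk x x → Set
  Chord W = ∃₂ λ a b → Σ (Split W a b) λ s →
    Adjacent b a × 2 ≤ lengthʷ (Split.middle s) × 2 ≤ lengthʷ (Split.front s) + lengthʷ (Split.back s)

  Chordless : ∀ {x} → Walk x x → Set
  Chordless W = ∀ {e} → e ∈ₗ E → proj₁ e ∈ₗ verticesʷ W → proj₂ e ∈ₗ verticesʷ W → e ∈ₗ edgesʷ W

  edgeOf-forward : ∀ {p q} (a : Adjacent p q) → (p , q) ∈ₗ E → edgeOf a ≡ (p , q)
  edgeOf-forward (inj₁ _)    _     = refl
  edgeOf-forward (inj₂ qp∈E) pq∈E = ⊥-elim (<-asym (All.lookup (ordered G) pq∈E) (All.lookup (ordered G) qp∈E))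

  edgeOf-backward : ∀ {p q} (a : Adjacent q p) → (p , q) ∈ₗ E → edgeOf a ≡ (p , q)
  edgeOf-backward (inj₁ qp∈E) pq∈E = ⊥-elim (<-asym (All.lookup (ordered G) pq∈E) (All.lookup (ordered G) qp∈E))
  edgeOf-backward (inj₂ _)    _     = refl

  chord-split : ∀ {x} (W : Walk x x) {p q} → (p , q) ∈ₗ E → p ∈ₗ verticesʷ W → q ∈ₗ verticesʷ W → (p , q) ∉ₗ edgesʷ W → Chord W
  chord-split {x} W {p} {q} pq∈E p∈W q∈W pq∉W with splitAt W p∈W
  ... | P₁ , Q₁ , P₁++Q₁≡W , 1≤Q₁ with ∈-++⁻ (verticesʷ P₁) (subst (q ∈ₗ_) (trans (cong verticesʷ (sym P₁++Q₁≡W)) (verticesʷ-++ P₁ Q₁)) q∈W)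
  ...   | inj₂ q∈Q₁ with splitAt Q₁ q∈Q₁
  ...     | R , Q , R++Q≡Q₁ , 1≤Q = p , q , parts , inj₂ pq∈E , middle≥2 R Q R++Q≡Q₁ , outer≥2 P₁ R Q 1≤Q (Split.splits parts)
    where
    parts : Split W p q
    parts = split P₁ R Q (trans (cong (P₁ ++ʷ_) R++Q≡Q₁) P₁++Q₁≡W)
    middle≥2 : (R′ : Walk p q) (Q′ : Walk q x) → R′ ++ʷ Q′ ≡ Q₁ → 2 ≤ lengthʷ R′
    middle≥2 []           _  _ = ⊥-elim (no-loop pq∈E refl)
    middle≥2 (a ∷ [])     Q′ R′++Q′≡Q₁ = ⊥-elim (pq∉W (subst (_∈ₗ edgesʷ W) (edgeOf-forward a pq∈E)
                                            (Split.edges-middle (split P₁ (a ∷ []) Q′ (trans (cong (P₁ ++ʷ_) R′++Q′≡Q₁) P₁++Q₁≡W)) (here refl))))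
    middle≥2 (_ ∷ _ ∷ _)  _  _ = s≤s (s≤s z≤n)
    outer≥2 : (P′ : Walk x p) (R′ : Walk p q) (Q′ : Walk q x) → 1 ≤ lengthʷ Q′ → P′ ++ʷ (R′ ++ʷ Q′) ≡ W → 2 ≤ lengthʷ P′ + lengthʷ Q′
    outer≥2 []       R′ (a ∷ [])    _ splits = ⊥-elim (pq∉W (subst (_∈ₗ edgesʷ W) (edgeOf-backward a pq∈E)
                                                  (Split.edges-back (split [] R′ (a ∷ []) splits) (here refl))))
    outer≥2 []       R′ (_ ∷ _ ∷ _) _ _ = s≤s (s≤s z≤n)
    outer≥2 (_ ∷ P′) R′ (_ ∷ Q′)    _ _ = s≤s (subst (1 ≤_) (sym (+-suc (lengthʷ P′) (lengthʷ Q′))) (s≤s z≤n))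
  chord-split {x} W {p} {q} pq∈E p∈W q∈W pq∉W | P₁ , Q₁ , P₁++Q₁≡W , 1≤Q₁ | inj₁ q∈P₁ with splitAt P₁ q∈P₁
  ... | P , R , P++R≡P₁ , _ = q , p , parts , inj₁ pq∈E , middle≥2 P R P++R≡P₁ , outer≥2 P R Q₁ 1≤Q₁ (Split.splits parts)
    where
    parts : Split W q p
    parts = split P R Q₁ (trans (sym (++ʷ-assoc P R Q₁)) (trans (cong (_++ʷ Q₁) P++R≡P₁) P₁++Q₁≡W))
    middle≥2 : (P′ : Walk x q) (R′ : Walk q p) → P′ ++ʷ R′ ≡ P₁ → 2 ≤ lengthʷ R′
    middle≥2 _  []          _ = ⊥-elim (no-loop pq∈E refl)
    middle≥2 P′ (a ∷ [])    P′++R′≡P₁ = ⊥-elim (pq∉W (subst (_∈ₗ edgesʷ W) (edgeOf-backward a pq∈E)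
                                           (Split.edges-middle (split P′ (a ∷ []) Q₁ (trans (sym (++ʷ-assoc P′ (a ∷ []) Q₁)) (trans (cong (_++ʷ Q₁) P′++R′≡P₁) P₁++Q₁≡W))) (here refl))))
    middle≥2 _  (_ ∷ _ ∷ _) _ = s≤s (s≤s z≤n)
    outer≥2 : (P′ : Walk x q) (R′ : Walk q p) (Q′ : Walk p x) → 1 ≤ lengthʷ Q′ → P′ ++ʷ (R′ ++ʷ Q′) ≡ W → 2 ≤ lengthʷ P′ + lengthʷ Q′
    outer≥2 []       R′ (a ∷ [])    _ splits = ⊥-elim (pq∉W (subst (_∈ₗ edgesʷ W) (edgeOf-forward a pq∈E)
                                                  (Split.edges-back (split [] R′ (a ∷ []) splits) (here refl))))
    outer≥2 []       R′ (_ ∷ _ ∷ _) _ _ = s≤s (s≤s z≤n)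
    outer≥2 (_ ∷ P′) R′ (_ ∷ Q′)    _ _ = s≤s (subst (1 ≤_) (sym (+-suc (lengthʷ P′) (lengthʷ Q′))) (s≤s z≤n))

  chord-or-chordless : ∀ {x} (W : Walk x x) → Chord W ⊎ Chordless W
  chord-or-chordless W with any? (λ e → (proj₁ e ∈ᵛ? verticesʷ W) ×-dec ((proj₂ e ∈ᵛ? verticesʷ W) ×-dec ¬? (e ∈ᵉ? edgesʷ W))) E
  ... | yes chord with find chord
  ...   | _ , e∈E , p∈W , q∈W , e∉W = inj₁ (chord-split W e∈E p∈W q∈W e∉W)
  chord-or-chordless W | no ¬chord = inj₂ chordless
    where
    chordless : Chordless W
    chordless {e} e∈E p∈W q∈W with e ∈ᵉ? edgesʷ W
    ... | yes e∈W = e∈W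
    ... | no e∉W  = ⊥-elim (All.lookup (¬Any⇒All¬ E ¬chord) e∈E (p∈W , q∈W , e∉W))

  odd-three-parts : ∀ p r q → p xor (r xor q) ≡ true → r ≡ true ⊎ q xor p ≡ true
  odd-three-parts true  true  q     _ = inj₁ refl
  odd-three-parts true  false true  ()
  odd-three-parts true  false false _ = inj₂ refl
  odd-three-parts false true  q     _ = inj₁ refl
  odd-three-parts false false true  _ = inj₂ refl
  odd-three-parts false false false ()

  odd-three-parts-chord : ∀ p r q → p xor (r xor q) ≡ true → r xor true ≡ true ⊎ not (q xor p) ≡ true
  odd-three-parts-chord p     false q     _ = inj₁ refl
  odd-three-parts-chord true  true  true  _ = inj₂ refl
  odd-three-parts-chord true  true  false ()
  odd-three-parts-chord false true  true  ()
  odd-three-parts-chord false true  false _ = inj₂ refl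

  record OddCycle (C : Subset n) : Set where
    constructor oddCycle
    field
      {start}   : Fin n
      cycle     : Walk start start
      cycle-odd       : oddʷ cycle ≡ true
      cycle-simple    : Unique (verticesʷ cycle)
      cycle-chordless : Chordless cycle
      cycle⊆C         : ∀ {v} → v ∈ₗ verticesʷ cycle → v ∈ C

  module Shortening (C : Subset n) (closed : ∀ {a b} → a ∈ C → Adjacent a b → b ∈ C) where

    end∈C : ∀ {x y} → x ∈ C → Walk x y → y ∈ C
    end∈C x∈C []      = x∈C
    end∈C x∈C (a ∷ w) = end∈C (closed x∈C a) w

    verticesʷ⊆C : ∀ {x y} → x ∈ C → (W : Walk x y) → ∀ {v} → v ∈ₗ verticesʷ W → v ∈ C
    verticesʷ⊆C x∈C (a ∷ w) (here refl)  = x∈C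
    verticesʷ⊆C x∈C (a ∷ w) (there v∈w) = verticesʷ⊆C (closed x∈C a) w v∈w

    -- A shortest odd closed walk is a chordless odd cycle: a repeated vertex or a chord splits
    -- the walk into two shorter closed walks, one of which is odd.
    shorten : ∀ fuel {x} (W : Walk x x) → lengthʷ W < fuel → oddʷ W ≡ true → x ∈ C → OddCycle C
    shorten (suc fuel) {x} W W<fuel oddW x∈C with unique-or-repetition W
    ... | inj₂ (v , parts@(split P R Q _) , 1≤R , 1≤Q) =
      case-odd (odd-three-parts (oddʷ P) (oddʷ R) (oddʷ Q) (trans (sym (Split.odd-split parts)) oddW))
      where
      W≡ = Split.length-split parts
      case-odd : oddʷ R ≡ true ⊎ oddʷ Q xor oddʷ P ≡ true → OddCycle C
      case-odd (inj₁ oddR) = shorten fuel R (≤-trans R<W (≤-pred W<fuel)) oddR (end∈C x∈C P)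
        where
        R<W : lengthʷ R < lengthʷ W
        R<W = begin-strict
          lengthʷ R                                      <⟨ m<m+n (lengthʷ R) 1≤Q ⟩
          lengthʷ R + lengthʷ Q                          ≤⟨ m≤n+m _ (lengthʷ P) ⟩
          lengthʷ P + (lengthʷ R + lengthʷ Q)            ≡⟨ sym W≡ ⟩
          lengthʷ W                                      ∎
          where open ≤-Reasoning
      case-odd (inj₂ oddQP) = shorten fuel (Q ++ʷ P) (≤-trans QP<W (≤-pred W<fuel)) (trans (oddʷ-++ Q P) oddQP) (end∈C x∈C P)
        where
        QP<W : lengthʷ (Q ++ʷ P) < lengthʷ W
        QP<W = begin-strict
          lengthʷ (Q ++ʷ P)                              ≡⟨ trans (lengthʷ-++ Q P) (+-comm (lengthʷ Q) (lengthʷ P)) ⟩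
          lengthʷ P + lengthʷ Q                          <⟨ +-monoʳ-< (lengthʷ P) (m<n+m (lengthʷ Q) 1≤R) ⟩
          lengthʷ P + (lengthʷ R + lengthʷ Q)            ≡⟨ sym W≡ ⟩
          lengthʷ W                                      ∎
          where open ≤-Reasoning
    ... | inj₁ simple with chord-or-chordless W
    ...   | inj₂ chordless = oddCycle W oddW simple chordless (verticesʷ⊆C x∈C W)
    ...   | inj₁ (a , b , parts@(split P R Q _) , ba , 2≤R , 2≤P+Q) =
      case-odd (odd-three-parts-chord (oddʷ P) (oddʷ R) (oddʷ Q) (trans (sym (Split.odd-split parts)) oddW))
      where
      W≡ = Split.length-split parts
      a∈C = end∈C x∈C P
      case-odd : oddʷ R xor true ≡ true ⊎ not (oddʷ Q xor oddʷ P) ≡ true → OddCycle C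
      case-odd (inj₁ oddR+) = shorten fuel (R ++ʷ (ba ∷ [])) (≤-trans R+<W (≤-pred W<fuel)) (trans (oddʷ-++ R (ba ∷ [])) oddR+) a∈C
        where
        R+<W : lengthʷ (R ++ʷ (ba ∷ [])) < lengthʷ W
        R+<W = begin-strict
          lengthʷ (R ++ʷ (ba ∷ []))                      ≡⟨ trans (lengthʷ-++ R (ba ∷ [])) (+-comm (lengthʷ R) 1) ⟩
          suc (lengthʷ R)                                <⟨ +-monoˡ-< (lengthʷ R) 2≤P+Q ⟩
          lengthʷ P + lengthʷ Q + lengthʷ R              ≡⟨ ℕ-solve 3 (λ p q r → p :+ q :+ r := p :+ (r :+ q)) refl (lengthʷ P) (lengthʷ Q) (lengthʷ R) ⟩
          lengthʷ P + (lengthʷ R + lengthʷ Q)            ≡⟨ sym W≡ ⟩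
          lengthʷ W                                      ∎
          where open ≤-Reasoning
      case-odd (inj₂ odd+QP) = shorten fuel (Adjacent-sym ba ∷ (Q ++ʷ P)) (≤-trans +QP<W (≤-pred W<fuel)) (trans (cong not (oddʷ-++ Q P)) odd+QP) a∈C
        where
        +QP<W : lengthʷ (Adjacent-sym ba ∷ (Q ++ʷ P)) < lengthʷ W
        +QP<W = begin-strict
          suc (lengthʷ (Q ++ʷ P))                        ≡⟨ cong suc (trans (lengthʷ-++ Q P) (+-comm (lengthʷ Q) (lengthʷ P))) ⟩
          suc (lengthʷ P + lengthʷ Q)                    <⟨ ≤-reflexive (ℕ-solve 2 (λ p q → con 2 :+ (p :+ q) := p :+ (con 2 :+ q)) refl (lengthʷ P) (lengthʷ Q)) ⟩
          lengthʷ P + (2 + lengthʷ Q)                    ≤⟨ +-monoʳ-≤ (lengthʷ P) (+-monoˡ-≤ (lengthʷ Q) 2≤R) ⟩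
          lengthʷ P + (lengthʷ R + lengthʷ Q)            ≡⟨ sym W≡ ⟩
          lengthʷ W                                      ∎
          where open ≤-Reasoning

module WalkColouring (m : ℕ) {n : ℕ} (G : Graph n) where

  open Construction m G
  open Walks G

  module Along (f₀ : Edge n → Fin k) where

    R : Fin n → ℕ
    R v = sumAt f₀ v

    -- Walking from a vertex that has already received c, the next edge takes the colour that
    -- balances that vertex; carry w c is what the far end of the walk receives.
    carry : ∀ {a y} → Walk a y → ℕ → ℕ
    carry       []      c = c
    carry {a} (_ ∷ w) c = carry w (toℕ (complement (R a + c)))

    colourWalk : ∀ {a y} → Walk a y → (Edge n → Fin k) → ℕ → Edge n → Fin k
    colourWalk       []      f c = f
    colourWalk {a} (s ∷ w) f c = colourWalk w (f [ edgeOf s ≔ complement (R a + c) ]) (toℕ (complement (R a + c)))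

    -- carry w is x ↦ c + x along an even walk and x ↦ c - x along an odd one (modulo k),
    -- stated without subtraction.
    carry-affine : ∀ {a y} (w : Walk a y) x z →
      (oddʷ w ≡ false → carry w x + z ≈ carry w z + x) × (oddʷ w ≡ true → carry w x + x ≈ carry w z + z)
    carry-affine []          x z = (λ _ → ≡⇒≈ (+-comm x z)) , λ ()
    carry-affine {a} (s ∷ w) x z = when-even , when-odd
      where
      x′ = toℕ (complement (R a + x))
      z′ = toℕ (complement (R a + z))
      A = carry w x′
      B = carry w z′
      x′+x≈z′+z : x′ + x ≈ z′ + z
      x′+x≈z′+z = ≈-trans (complement-shift (R a) x) (≈-sym (complement-shift (R a) z))
      when-even : not (oddʷ w) ≡ false → A + z ≈ B + x
      when-even odd-w = +-cancelʳ-≈ (x′ + x) (begin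
        A + z + (x′ + x)      ≡⟨ ℕ-solve 4 (λ A z x′ x → A :+ z :+ (x′ :+ x) := A :+ x′ :+ (x :+ z)) refl A z x′ x ⟩
        A + x′ + (x + z)      ≈⟨ +-cong-≈ (proj₂ (carry-affine w x′ z′) (not-injective odd-w)) (≈-refl {x + z}) ⟩
        B + z′ + (x + z)      ≡⟨ ℕ-solve 4 (λ B z′ x z → B :+ z′ :+ (x :+ z) := B :+ x :+ (z′ :+ z)) refl B z′ x z ⟩
        B + x + (z′ + z)      ≈⟨ +-cong-≈ (≈-refl {B + x}) (≈-sym x′+x≈z′+z) ⟩
        B + x + (x′ + x)      ∎)
        where open SetoidReasoning ≈-setoid
      when-odd : not (oddʷ w) ≡ true → A + x ≈ B + z
      when-odd odd-w = +-cancelʳ-≈ (x′ + z′) (begin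
        A + x + (x′ + z′)     ≡⟨ ℕ-solve 4 (λ A x x′ z′ → A :+ x :+ (x′ :+ z′) := A :+ z′ :+ (x′ :+ x)) refl A x x′ z′ ⟩
        A + z′ + (x′ + x)     ≈⟨ +-cong-≈ (proj₁ (carry-affine w x′ z′) (not-injective odd-w)) x′+x≈z′+z ⟩
        B + x′ + (z′ + z)     ≡⟨ ℕ-solve 4 (λ B x′ z′ z → B :+ x′ :+ (z′ :+ z) := B :+ z :+ (x′ :+ z′)) refl B x′ z′ z ⟩
        B + z + (x′ + z′)     ∎)
        where open SetoidReasoning ≈-setoid

    record Coloured {a y} (w : Walk a y) (f : Edge n → Fin k) (c : ℕ) : Set where
      field
        on-walk   : ∀ {v} → v ∈ₗ verticesʷ w → k ∣ sumAt (colourWalk w f c) v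
        off-walk  : ∀ {v} → v ∉ₗ verticesʷ w → v ≢ y → sumAt (colourWalk w f c) v ≡ sumAt f v
        at-end    : 1 ≤ lengthʷ w → sumAt (colourWalk w f c) y ≡ sumAt f y + carry w c
        elsewhere : ∀ {e} → e ∉ₗ edgesʷ w → colourWalk w f c e ≡ f e

    arrival : ∀ {a b y} (s : Adjacent a b) (w : Walk b y) f colour → y ∉ₗ verticesʷ w → a ≢ y →
              edgeOf s ∈ₗ E → f (edgeOf s) ≡ zero →
              let f₁ = f [ edgeOf s ≔ colour ] in
              (1 ≤ lengthʷ w → sumAt (colourWalk w f₁ (toℕ colour)) y ≡ sumAt f₁ y + carry w (toℕ colour)) →
              sumAt (colourWalk w f₁ (toℕ colour)) y ≡ sumAt f y + carry w (toℕ colour)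
    arrival s []      f colour _  _   e∈E fe≡0 _ = sumAt-[≔]-endpoint f colour e∈E fe≡0 (target∈ₑedgeOf s)
    arrival s (t ∷ w) f colour y∉ a≢y e∈E fe≡0 at-end-w =
      trans (at-end-w (s≤s z≤n)) (cong (_+ _) (sumAt-[≔]-other f colour e∈E fe≡0 y∉ₑe))
      where
      y∉ₑe : ¬ (_ ∈ₑ edgeOf s)
      y∉ₑe y∈ₑe with ∈ₑedgeOf s y∈ₑe
      ... | inj₁ y≡a = a≢y (sym y≡a)
      ... | inj₂ refl = y∉ (here refl)

    colourWalk-coloured : ∀ {a y} (w : Walk a y) f c →
      Unique (verticesʷ w) → y ∉ₗ verticesʷ w → (∀ {e} → e ∈ₗ edgesʷ w → f e ≡ zero) →
      (a ∈ₗ verticesʷ w → sumAt f a ≡ R a + c) → (∀ {v} → v ∈ₗ verticesʷ w → v ≢ a → sumAt f v ≡ R v) →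
      Coloured w f c
    colourWalk-coloured [] f c _ _ _ _ _ = record { on-walk = λ () ; off-walk = λ _ _ → refl ; at-end = λ () ; elsewhere = λ _ → refl }
    colourWalk-coloured {a} {y} (_∷_ {y = b} s w) f c (a∉w ∷ simple) y∉ fresh start rest = record
      { on-walk = on-walk ; off-walk = off-walk ; at-end = at-end ; elsewhere = elsewhere }
      where
      colour = complement (R a + c)
      e₀ = edgeOf s
      f₁ = f [ e₀ ≔ colour ]
      a∉w′ : a ∉ₗ verticesʷ w
      a∉w′ a∈w = All.lookup a∉w a∈w refl
      a≢y : a ≢ y
      a≢y refl = y∉ (here refl)
      e₀∉w : e₀ ∉ₗ edgesʷ w
      e₀∉w e₀∈w with endpoint-on-walk w e₀∈w (source∈ₑedgeOf s)
      ... | inj₁ a∈w = a∉w′ a∈w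
      ... | inj₂ a≡y = a≢y a≡y
      fe₀≡0 = fresh (here refl)
      e₀∈E = edgeOf∈E s
      unchanged : ∀ {v} → ¬ (v ∈ₑ e₀) → sumAt f₁ v ≡ sumAt f v
      unchanged = sumAt-[≔]-other f colour e₀∈E fe₀≡0
      IH : Coloured w f₁ (toℕ colour)
      IH = colourWalk-coloured w f₁ (toℕ colour) simple (y∉ ∘ there)
             (λ {e} e∈w → trans ([≔]-other f e₀ colour (λ { refl → e₀∉w e∈w })) (fresh (there e∈w)))
             (λ b∈w → trans (sumAt-[≔]-endpoint f colour e₀∈E fe₀≡0 (target∈ₑedgeOf s))
                            (cong (_+ toℕ colour) (rest (there b∈w) λ { refl → a∉w′ b∈w })))
             (λ {v} v∈w v≢b → trans (unchanged (λ v∈ₑe₀ → [ (λ { refl → a∉w′ v∈w }) , v≢b ]′ (∈ₑedgeOf s v∈ₑe₀)))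
                                     (rest (there v∈w) λ { refl → a∉w′ v∈w }))
      open Coloured IH renaming (on-walk to on-w; off-walk to off-w; at-end to at-end-w; elsewhere to elsewhere-w)
      on-walk : ∀ {v} → v ∈ₗ verticesʷ (s ∷ w) → k ∣ sumAt (colourWalk w f₁ (toℕ colour)) v
      on-walk (here refl) = subst (k ∣_) (sym (begin
        sumAt (colourWalk w f₁ (toℕ colour)) a  ≡⟨ off-w a∉w′ a≢y ⟩
        sumAt f₁ a                              ≡⟨ sumAt-[≔]-endpoint f colour e₀∈E fe₀≡0 (source∈ₑedgeOf s) ⟩
        sumAt f a + toℕ colour                  ≡⟨ cong (_+ toℕ colour) (start (here refl)) ⟩
        R a + c + toℕ colour                    ∎)) (complement-∣ (R a + c))
        where open ≡-Reasoning
      on-walk (there v∈w) = on-w v∈w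
      off-walk : ∀ {v} → v ∉ₗ verticesʷ (s ∷ w) → v ≢ y → sumAt (colourWalk w f₁ (toℕ colour)) v ≡ sumAt f v
      off-walk {v} v∉ v≢y = trans (off-w (v∉ ∘ there) v≢y) (unchanged v∉ₑe₀)
        where
        v∉ₑe₀ : ¬ (v ∈ₑ e₀)
        v∉ₑe₀ v∈ₑe₀ with ∈ₑedgeOf s v∈ₑe₀
        ... | inj₁ refl = v∉ (here refl)
        ... | inj₂ refl with start∈verticesʷ w
        ...   | inj₁ b∈w = v∉ (there b∈w)
        ...   | inj₂ b≡y = v≢y b≡y
      at-end : 1 ≤ lengthʷ (s ∷ w) → sumAt (colourWalk w f₁ (toℕ colour)) y ≡ sumAt f y + carry w (toℕ colour)
      at-end _ = arrival s w f colour (y∉ ∘ there) a≢y e₀∈E fe₀≡0 at-end-w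
      elsewhere : ∀ {e} → e ∉ₗ edgesʷ (s ∷ w) → colourWalk w f₁ (toℕ colour) e ≡ f e
      elsewhere e∉ = trans (elsewhere-w (e∉ ∘ there)) ([≔]-other f e₀ colour (e∉ ∘ here))

  closing-walk-nonempty : ∀ {y w₁} (a₀ : Adjacent y w₁) (W′ : Walk w₁ y) → 1 ≤ lengthʷ W′
  closing-walk-nonempty (inj₁ yy∈E) [] = ⊥-elim (no-loop yy∈E refl)
  closing-walk-nonempty (inj₂ yy∈E) [] = ⊥-elim (no-loop yy∈E refl)
  closing-walk-nonempty a₀ (_ ∷ _) = s≤s z≤n

  first-edge-not-repeated : ∀ {y w₁} (a₀ : Adjacent y w₁) (W′ : Walk w₁ y) →
                            Unique (verticesʷ (a₀ ∷ W′)) → oddʷ W′ ≡ false → edgeOf a₀ ∉ₗ edgesʷ W′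
  first-edge-not-repeated a₀ []        _ _  ()
  first-edge-not-repeated a₀ (s₁ ∷ []) _ ()
  first-edge-not-repeated {y} a₀ (s₁ ∷ W″@(_ ∷ _)) (y∉W′ ∷ w₁∉W″ ∷ _) _ = e₀∉W′
    where
    y∉W′ₗ : y ∉ₗ verticesʷ (s₁ ∷ W″)
    y∉W′ₗ y∈W′ = All.lookup y∉W′ y∈W′ refl
    e₀∉W′ : edgeOf a₀ ∉ₗ edgesʷ (s₁ ∷ W″)
    e₀∉W′ (here e₀≡e₁) with ∈ₑedgeOf s₁ (subst (y ∈ₑ_) e₀≡e₁ (source∈ₑedgeOf a₀))
    ... | inj₁ refl = y∉W′ₗ (here refl)
    ... | inj₂ refl = y∉W′ₗ (there (here refl))
    e₀∉W′ (there e₀∈W″) with endpoint-on-walk W″ e₀∈W″ (target∈ₑedgeOf a₀)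
    ... | inj₁ w₁∈W″ = All.lookup w₁∉W″ w₁∈W″ refl
    ... | inj₂ refl  = y∉W′ₗ (here refl)

  module AroundCycle {C y} (closed : Closed C)
                     (W : Walk y y) (simple : Unique (verticesʷ W)) (chordless : Chordless W)
                     (W⊆C : ∀ {v} → v ∈ₗ verticesʷ W → v ∈ C) where

    S = verticesʷ W
    C₂ = C -ₗ S

    open FilterSplit (Touches? C) (Touches? C₂) (Touches-⊆ (-ₗ-⊆ C S)) public

    X = filter P∖Q? E

    X⊆W : ∀ {e} → e ∈ₗ X → e ∈ₗ edgesʷ W
    X⊆W e∈X with ∈-filter⁻ P∖Q? {xs = E} e∈X
    ... | e∈E , touch , ¬touch₂ = chordless e∈E (in-S (proj₁ ends) (¬touch₂ ∘ inj₁)) (in-S (proj₂ ends) (¬touch₂ ∘ inj₂))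
      where
      ends = closed e∈E touch
      in-S : ∀ {v} → v ∈ C → v ∉ C₂ → v ∈ₗ S
      in-S {v} v∈C v∉C₂ with v ∈ᵛ? S
      ... | yes v∈S = v∈S
      ... | no v∉S  = ⊥-elim (v∉C₂ (∈∧∉⇒∈-ₗ C S v∈C v∉S))

    X≤W : length X ≤ lengthʷ W
    X≤W = ≤-trans (Unique-⊆⇒length≤ X (edgesʷ W) (Unique.filter⁺ P∖Q? (unique G)) X⊆W) (≤-reflexive (length-edgesʷ W))

    ∣C₂∣+W≤∣C∣ : ∣ C₂ ∣ + lengthʷ W ≤ ∣ C ∣
    ∣C₂∣+W≤∣C∣ = subst (λ l → ∣ C₂ ∣ + l ≤ ∣ C ∣) (length-verticesʷ W) (∣-ₗ∣+length≤ C S simple W⊆C)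

    partial-small-cycle : Empty C₂ → Partial C
    partial-small-cycle empty = partial-blank C (begin
      length (EV₀ G C)                  ≡⟨ length-filter-split E ⟩
      length (EV₀ G C₂) + length X      ≡⟨ cong (λ A → length A + length X) (EV₀-empty C₂ empty) ⟩
      length X                          ≤⟨ X≤W ⟩
      lengthʷ W                         ≤⟨ m≤n+m (lengthʷ W) ∣ C₂ ∣ ⟩
      ∣ C₂ ∣ + lengthʷ W                ≤⟨ ∣C₂∣+W≤∣C∣ ⟩
      ∣ C ∣                             ∎)
      where open ≤-Reasoning

  -- Colour a chordless odd cycle through y last: its first edge gets h and the rest is coloured
  -- along the cycle back to y, which then receives h + carry(h) ≈ 2h + carry(0); choosing h as
  -- half of the missing residue (k is odd) balances y as well.
  partial-odd-cycle : ∀ {C y} → Closed C →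
                      (W : Walk y y) → oddʷ W ≡ true → Unique (verticesʷ W) → Chordless W →
                      (∀ {v} → v ∈ₗ verticesʷ W → v ∈ C) → 1 ≤ ∣ C -ₗ verticesʷ W ∣ →
                      Partial (C -ₗ verticesʷ W) → Partial C
  partial-odd-cycle closed []           ()
  partial-odd-cycle {C} {y} closed W@(_∷_ {y = w₁} a₀ W′) oddW (y∉W′ ∷ simple′) chordless W⊆C 1≤∣C₂∣ r₂ =
    partial f (position r₂) balanced′ blank′ consumed′ count′
    where
    open AroundCycle closed W (y∉W′ ∷ simple′) chordless W⊆C
    f₀ = colouring r₂
    open Along f₀

    y∉W′ₗ : y ∉ₗ verticesʷ W′
    y∉W′ₗ y∈W′ = All.lookup y∉W′ y∈W′ refl

    on-walk⇒∈S : ∀ {e} → e ∈ₗ edgesʷ W → ∀ {v} → v ∈ₑ e → v ∈ₗ S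
    on-walk⇒∈S e∈W v∈ₑe with endpoint-on-walk W e∈W v∈ₑe
    ... | inj₁ v∈S  = v∈S
    ... | inj₂ refl = here refl

    walk-edge-off-C₂ : ∀ {e} → e ∈ₗ edgesʷ W → ¬ Touches C₂ e
    walk-edge-off-C₂ e∈W (inj₁ p∈C₂) = ∈-ₗ⇒∉ C S p∈C₂ (on-walk⇒∈S e∈W (inj₁ refl))
    walk-edge-off-C₂ e∈W (inj₂ q∈C₂) = ∈-ₗ⇒∉ C S q∈C₂ (on-walk⇒∈S e∈W (inj₂ refl))

    g = toℕ (complement (R y + carry W′ 0))
    h = halveᶠ g
    e₀ = edgeOf a₀
    f₁ = f₀ [ e₀ ≔ h ]
    fe₀≡0 = blank-off r₂ (walk-edge-off-C₂ (here refl))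
    e₀∈E = edgeOf∈E a₀

    W′-even : oddʷ W′ ≡ false
    W′-even = not-injective oddW

    e₀∉W′ : e₀ ∉ₗ edgesʷ W′
    e₀∉W′ = first-edge-not-repeated a₀ W′ (y∉W′ ∷ simple′) W′-even

    away-from-e₀ : ∀ {v} → v ≢ y → v ≢ w₁ → ¬ (v ∈ₑ e₀)
    away-from-e₀ v≢y v≢w₁ v∈ₑe₀ = [ v≢y , v≢w₁ ]′ (∈ₑedgeOf a₀ v∈ₑe₀)

    coloured : Coloured W′ f₁ (toℕ h)
    coloured = colourWalk-coloured W′ f₁ (toℕ h) simple′ y∉W′ₗ
      (λ {e} e∈W′ → trans ([≔]-other f₀ e₀ h (λ { refl → e₀∉W′ e∈W′ })) (blank-off r₂ (walk-edge-off-C₂ (there e∈W′))))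
      (λ _ → sumAt-[≔]-endpoint f₀ h e₀∈E fe₀≡0 (target∈ₑedgeOf a₀))
      (λ {v} v∈W′ v≢w₁ → sumAt-[≔]-other f₀ h e₀∈E fe₀≡0 (away-from-e₀ (λ { refl → y∉W′ₗ v∈W′ }) v≢w₁))
    open Coloured coloured

    f = colourWalk W′ f₁ (toℕ h)

    balanced-y : k ∣ sumAt f y
    balanced-y = ≈0⇒∣ (begin
      sumAt f y                                 ≡⟨ at-end (closing-walk-nonempty a₀ W′) ⟩
      sumAt f₁ y + carry W′ (toℕ h)             ≡⟨ cong (_+ carry W′ (toℕ h)) (sumAt-[≔]-endpoint f₀ h e₀∈E fe₀≡0 (source∈ₑedgeOf a₀)) ⟩
      R y + toℕ h + carry W′ (toℕ h)            ≡⟨ ℕ-solve 3 (λ r h c → r :+ h :+ c := r :+ (c :+ con 0) :+ h) refl (R y) (toℕ h) (carry W′ (toℕ h)) ⟩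
      R y + (carry W′ (toℕ h) + 0) + toℕ h      ≈⟨ +-cong-≈ (+-cong-≈ (≈-refl {R y}) (proj₁ (carry-affine W′ (toℕ h) 0) W′-even)) (≈-refl {toℕ h}) ⟩
      R y + (carry W′ 0 + toℕ h) + toℕ h        ≡⟨ ℕ-solve 3 (λ r c h → r :+ (c :+ h) :+ h := r :+ c :+ (h :+ h)) refl (R y) (carry W′ 0) (toℕ h) ⟩
      R y + carry W′ 0 + (toℕ h + toℕ h)        ≈⟨ +-cong-≈ (≈-refl {R y + carry W′ 0}) (subst (λ x → x + x ≈ g) (sym (toℕ-halveᶠ g)) (halve-+-halve g)) ⟩
      R y + carry W′ 0 + g                      ≈⟨ complement-≈ (R y + carry W′ 0) ⟩
      0                                         ∎)
      where
      open SetoidReasoning ≈-setoid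

    balanced′ : ∀ {v} → v ∈ C → k ∣ sumAt f v
    balanced′ {v} v∈C with v ≟ y
    ... | yes refl = balanced-y
    ... | no v≢y with v ∈ᵛ? verticesʷ W′
    ...   | yes v∈W′ = on-walk v∈W′
    ...   | no v∉W′  = subst (k ∣_) (sym (trans (off-walk v∉W′ v≢y) (sumAt-[≔]-other f₀ h e₀∈E fe₀≡0 (away-from-e₀ v≢y v≢w₁))))
                              (balanced r₂ (∈∧∉⇒∈-ₗ C S v∈C v∉S))
      where
      v≢w₁ : v ≢ w₁
      v≢w₁ refl = [ v∉W′ , v≢y ]′ (start∈verticesʷ W′)
      v∉S : v ∉ₗ S
      v∉S (here v≡y)  = v≢y v≡y
      v∉S (there v∈W′) = v∉W′ v∈W′

    unchanged-off-walk : ∀ {e} → e ∉ₗ edgesʷ W → f e ≡ f₀ e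
    unchanged-off-walk e∉W = trans (elsewhere (e∉W ∘ there)) ([≔]-other f₀ e₀ h (e∉W ∘ here))

    walk-edge-touches : ∀ {e} → e ∈ₗ edgesʷ W → Touches C e
    walk-edge-touches e∈W = inj₁ (W⊆C (on-walk⇒∈S e∈W (inj₁ refl)))

    blank′ : ∀ {e} → ¬ Touches C e → f e ≡ zero
    blank′ ¬touch = trans (unchanged-off-walk (¬touch ∘ walk-edge-touches)) (blank-off r₂ (¬touch ∘ Touches-⊆ (-ₗ-⊆ C S)))

    consumed′ : consumed (position r₂) ≤ length (EV₀ G C)
    consumed′ = ≤-trans (consumed≤ r₂) (length-filter-mono E)

    count′ : ∀ c → colourCount (EV₀ G C) f c ≤ occurrences c (position r₂) + (∣ C ∣ ∸ 1) + indicator (c ≟ zero)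
    count′ c = begin
      colourCount (EV₀ G C) f c                                     ≡⟨ length-filter-filter-split {R = λ e → f e ≡ c} (λ e → f e ≟ c) E ⟩
      colourCount (EV₀ G C₂) f c + colourCount X f c                ≡⟨ cong (_+ colourCount X f c) (colourCount-cong (EV₀ G C₂) f f₀ c (λ e∈ → unchanged-off-walk (λ e∈W → walk-edge-off-C₂ e∈W (proj₂ (∈-filter⁻ (Touches? C₂) {xs = E} e∈))))) ⟩
      colourCount (EV₀ G C₂) f₀ c + colourCount X f c               ≤⟨ +-mono-≤ (colourCount≤ r₂ c) (≤-trans (colourCount≤length X f c) X≤W) ⟩
      occurrences c (position r₂) + (∣ C₂ ∣ ∸ 1) + i + lengthʷ W    ≡⟨ ℕ-solve 4 (λ o d i l → o :+ d :+ i :+ l := o :+ (d :+ l) :+ i) refl (occurrences c (position r₂)) (∣ C₂ ∣ ∸ 1) i (lengthʷ W) ⟩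
      occurrences c (position r₂) + (∣ C₂ ∣ ∸ 1 + lengthʷ W) + i    ≤⟨ +-monoˡ-≤ i (+-monoʳ-≤ (occurrences c (position r₂)) budget) ⟩
      occurrences c (position r₂) + (∣ C ∣ ∸ 1) + i                 ∎
      where
      open ≤-Reasoning
      i = indicator (c ≟ zero)
      budget : ∣ C₂ ∣ ∸ 1 + lengthʷ W ≤ ∣ C ∣ ∸ 1
      budget = subst (_≤ ∣ C ∣ ∸ 1) (+-∸-comm (lengthʷ W) 1≤∣C₂∣) (∸-monoˡ-≤ 1 ∣C₂∣+W≤∣C∣)

module Solution (m : ℕ) {n : ℕ} (G : Graph n) where

  open Construction m G
  open Bipartite m G
  open Walks G
  open WalkColouring m G

  partial-bipartite : ∀ {C u} → Closed C → (χ : Fin n → Bool) → (∀ {e} → e ∈ₗ E → Touches C e → χ (proj₁ e) ≢ χ (proj₂ e)) →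
                      u ∈ C → Partial (C - u) → Partial C
  partial-bipartite {C} {u} closed χ proper u∈C r =
    partial (colouring r) (position r) balanced′ blank′ (≤-trans (consumed≤ r) (length-filter-mono E)) count′
    where
    open Star C u
    C′ = C - u

    no-star : edges⋆ ≡ []
    no-star = filter-none P∖Q? {xs = E} (tabulate λ {e} e∈E (touch , ¬touch′) → ¬touch′ (still-touches e∈E touch))
      where
      still-touches : ∀ {e} → e ∈ₗ E → Touches C e → Touches C′ e
      still-touches {p , q} e∈E touch with p ≟ u | closed e∈E touch
      ... | yes refl | _ , q∈C = inj₂ (x∈p∧x≢y⇒x∈p-y q∈C (λ q≡p → no-loop e∈E (sym q≡p)))
      ... | no p≢u   | p∈C , _ = inj₁ (x∈p∧x≢y⇒x∈p-y p∈C p≢u)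

    balanced′ : ∀ {v} → v ∈ C → k ∣ sumAt (colouring r) v
    balanced′ {v} v∈C with v ≟ u
    ... | yes refl = bipartite-balanced C χ closed proper (colouring r) u∈C (λ v∈C v≢u → balanced r (x∈p∧x≢y⇒x∈p-y v∈C v≢u))
    ... | no v≢u   = balanced r (x∈p∧x≢y⇒x∈p-y v∈C v≢u)

    blank′ : ∀ {e} → ¬ Touches C e → colouring r e ≡ zero
    blank′ ¬touch = blank-off r (¬touch ∘ Touches-⊆ (p─q⊆p C _))

    count′ : ∀ c → colourCount (EV₀ G C) (colouring r) c ≤ occurrences c (position r) + (∣ C ∣ ∸ 1) + indicator (c ≟ zero)
    count′ c = begin
      colourCount (EV₀ G C) (colouring r) c                                ≡⟨ colourCount-EV₀ (colouring r) c ⟩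
      colourCount (EV₀ G C′) (colouring r) c + colourCount edges⋆ (colouring r) c ≡⟨ cong (λ B → colourCount (EV₀ G C′) (colouring r) c + colourCount B (colouring r) c) no-star ⟩
      colourCount (EV₀ G C′) (colouring r) c + 0                           ≡⟨ +-identityʳ _ ⟩
      colourCount (EV₀ G C′) (colouring r) c                               ≤⟨ colourCount≤ r c ⟩
      occurrences c (position r) + (∣ C′ ∣ ∸ 1) + indicator (c ≟ zero)     ≤⟨ +-monoˡ-≤ (indicator (c ≟ zero)) (+-monoʳ-≤ (occurrences c (position r)) (∸-monoˡ-≤ 1 (<⇒≤ (x∈p⇒∣p-x∣<∣p∣ u∈C)))) ⟩
      occurrences c (position r) + (∣ C ∣ ∸ 1) + indicator (c ≟ zero)      ∎
      where open ≤-Reasoning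

  Leaves : Subset n → Edge n → Set
  Leaves C e = (proj₁ e ∈ C × proj₂ e ∉ C) ⊎ (proj₂ e ∈ C × proj₁ e ∉ C)

  Leaves? : ∀ C → Decidable (Leaves C)
  Leaves? C e = ((proj₁ e ∈? C) ×-dec ¬? (proj₂ e ∈? C)) ⊎-dec ((proj₂ e ∈? C) ×-dec ¬? (proj₁ e ∈? C))

  leaving⇒star : ∀ {C e} → e ∈ₗ E → Leaves C e → ∃ λ u → u ∈ C × e ∈ₗ Star.edges⋆ C u
  leaving⇒star {C} {p , q} e∈E (inj₁ (p∈C , q∉C)) =
    p , p∈C , ∈-filter⁺ (Star.P∖Q? C p) e∈E (inj₁ p∈C , λ { (inj₁ p∈C-p) → x∈p-y⇒x≢y p∈C-p refl ; (inj₂ q∈C-p) → q∉C (p─q⊆p C _ q∈C-p) })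
  leaving⇒star {C} {p , q} e∈E (inj₂ (q∈C , p∉C)) =
    q , q∈C , ∈-filter⁺ (Star.P∖Q? C q) e∈E (inj₂ q∈C , λ { (inj₁ p∈C-q) → p∉C (p─q⊆p C _ p∈C-q) ; (inj₂ q∈C-q) → x∈p-y⇒x≢y q∈C-q refl })

  no-leaving⇒closed : ∀ {C} → ¬ Any (Leaves C) E → Closed C
  no-leaving⇒closed {C} ¬leaving {p , q} e∈E touch with p ∈? C | q ∈? C
  ... | yes p∈C | yes q∈C = p∈C , q∈C
  ... | yes p∈C | no q∉C  = ⊥-elim (All.lookup (¬Any⇒All¬ E ¬leaving) e∈E (inj₁ (p∈C , q∉C)))
  ... | no p∉C  | yes q∈C = ⊥-elim (All.lookup (¬Any⇒All¬ E ¬leaving) e∈E (inj₂ (q∈C , p∉C)))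
  ... | no p∉C  | no q∉C  = ⊥-elim ([ p∉C , q∉C ]′ touch)

  closed⇒adjacent-closed : ∀ {C} → Closed C → ∀ {a b} → a ∈ C → Adjacent a b → b ∈ C
  closed⇒adjacent-closed closed a∈C (inj₁ ab∈E) = proj₂ (closed ab∈E (inj₁ a∈C))
  closed⇒adjacent-closed closed a∈C (inj₂ ba∈E) = proj₁ (closed ba∈E (inj₂ a∈C))

  Smaller : Subset n → Set
  Smaller C = ∀ D → ∣ D ∣ < ∣ C ∣ → Partial D

  partial-leaving : ∀ {C e} → e ∈ₗ E → Leaves C e → Smaller C → Partial C
  partial-leaving {C} e∈E leaves rec with leaving⇒star e∈E leaves
  ... | u , u∈C , e∈⋆ with nonempty? (C - u)
  ...   | yes (v , v∈C-u) = partial-extend-star u∈C e∈⋆ (x∈p⇒1≤∣p∣ v∈C-u) (rec (C - u) (x∈p⇒∣p-x∣<∣p∣ u∈C))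
  ...   | no empty        = partial-last-star u∈C e∈⋆ empty

  partial-closed : ∀ {C w} → Closed C → w ∈ C → Smaller C → Partial C
  partial-closed {C} {w} closed w∈C rec with partition-or-conflict (EV₀ G C) (proj₁ ∘ ∈-filter⁻ (Touches? C) {xs = E})
  ... | inj₂ π = partial-bipartite closed (Partition.side π) (λ e∈E touch → Partition.proper π (∈-filter⁺ (Touches? C) e∈E touch)) w∈C
                   (rec (C - w) (x∈p⇒∣p-x∣<∣p∣ w∈C))
  ... | inj₁ (e , e∈EV₀ , W , oddW) with Shortening.shorten C (closed⇒adjacent-closed closed) (suc (lengthʷ W)) W ≤-refl oddW p∈C
    where
    p∈C = proj₁ (uncurry closed (∈-filter⁻ (Touches? C) {xs = E} e∈EV₀))
  ...   | oddCycle cycle odd-cycle simple chordless cycle⊆C with nonempty? (C -ₗ verticesʷ cycle)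
  ...     | no empty       = AroundCycle.partial-small-cycle closed cycle simple chordless cycle⊆C empty
  ...     | yes (v , v∈C₂) = partial-odd-cycle closed cycle odd-cycle simple chordless cycle⊆C (x∈p⇒1≤∣p∣ v∈C₂) (rec C₂ ∣C₂∣<∣C∣)
    where
    C₂ = C -ₗ verticesʷ cycle
    odd⇒nonempty : ∀ {x y} (w : Walk x y) → oddʷ w ≡ true → 1 ≤ lengthʷ w
    odd⇒nonempty (_ ∷ _) _ = s≤s z≤n
    ∣C₂∣<∣C∣ : ∣ C₂ ∣ < ∣ C ∣
    ∣C₂∣<∣C∣ = ≤-trans (subst (_≤ ∣ C₂ ∣ + lengthʷ cycle) (+-comm ∣ C₂ ∣ 1) (+-monoʳ-≤ ∣ C₂ ∣ (odd⇒nonempty cycle odd-cycle)))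
                       (AroundCycle.∣C₂∣+W≤∣C∣ closed cycle simple chordless cycle⊆C)

  partial-solution : ∀ fuel C → ∣ C ∣ < fuel → Partial C
  partial-solution (suc fuel) C ∣C∣≤fuel with nonempty? C
  ... | no empty = partial-blank C (≤-trans (≤-reflexive (cong length (EV₀-empty C empty))) z≤n)
  ... | yes (w , w∈C) with any? (Leaves? C) E
  ...   | yes leaving = partial-leaving (proj₁ (proj₂ (find leaving))) (proj₂ (proj₂ (find leaving))) rec
    where rec = λ D ∣D∣<∣C∣ → partial-solution fuel D (≤-trans ∣D∣<∣C∣ (≤-pred ∣C∣≤fuel))
  ...   | no ¬leaving = partial-closed (no-leaving⇒closed ¬leaving) w∈C rec
    where rec = λ D ∣D∣<∣C∣ → partial-solution fuel D (≤-trans ∣D∣<∣C∣ (≤-pred ∣C∣≤fuel))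

  theorem : ∀ V₀ → Σ (Edge n → Fin k) λ f →
            ((v : Fin n) → v ∈ V₀ → k ∣ s (EV₀ G V₀) f v) ×
            ((c : Fin k) → k * colourCount (EV₀ G V₀) f c ≤ length (EV₀ G V₀) + k * ∣ V₀ ∣)
  theorem V₀ = colouring r , (λ v v∈V₀ → subst (k ∣_) (sym (s-EV₀ V₀ (colouring r) v∈V₀)) (balanced r v∈V₀)) , bound
    where
    r = partial-solution (suc ∣ V₀ ∣) V₀ ≤-refl
    bound : ∀ c → k * colourCount (EV₀ G V₀) (colouring r) c ≤ length (EV₀ G V₀) + k * ∣ V₀ ∣
    bound c = by-cases (nonempty? V₀)
      where
      by-cases : Dec (Nonempty V₀) → k * colourCount (EV₀ G V₀) (colouring r) c ≤ length (EV₀ G V₀) + k * ∣ V₀ ∣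
      by-cases (yes (_ , v∈V₀)) = partial-bound r c (x∈p⇒1≤∣p∣ v∈V₀)
      by-cases (no empty)       = subst (λ A → k * colourCount A (colouring r) c ≤ length A + k * ∣ V₀ ∣) (sym (EV₀-empty V₀ empty))
                                        (subst (_≤ k * ∣ V₀ ∣) (sym (*-zeroʳ k)) z≤n)

lemma10 : (k m : ℕ) → k ≡ suc (2 * m) → (n : ℕ) → (G : Graph n) → (V₀ : Subset n) →
    Σ (Edge n → Fin k) (λ f →
      ((v : Fin n) → v ∈ V₀ → k ∣ s (EV₀ G V₀) f v)
      × ((c : Fin k) → k * colourCount (EV₀ G V₀) f c ≤ length (EV₀ G V₀) + k * ∣ V₀ ∣))
lemma10 .(suc (2 * m)) m refl n G V₀ = subst Good (cong suc (double≡2* m)) (Solution.theorem m G V₀)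
  where
  Good : ℕ → Set
  Good k = Σ (Edge n → Fin k) (λ f →
      ((v : Fin n) → v ∈ V₀ → k ∣ s (EV₀ G V₀) f v)
      × ((c : Fin k) → k * colourCount (EV₀ G V₀) f c ≤ length (EV₀ G V₀) + k * ∣ V₀ ∣))
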